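{- Let $n$, $k\ge1$, $l\ge1$ be integers, let $1\le s_{1,1}<\ldots<s_{1,k}<\frac n2$ and $1\le s_{2,1}<\ldots<s_{2,l}<\frac n2$ be integers, and let $C_1=C_n(s_{1,1},\ldots,s_{1,k})$ and $C_2=C_n(s_{2,1},\ldots,s_{2,l})$ be circulant graphs. Let $G$ be the cobordism of $C_1$ and $C_2$, and let $\widetilde{G}$ be the cone over $G$. Then $Jac(\widetilde{G})$ is isomorphic to the cokernel of the linear operator $\mathcal{A}^n-I$, where $\mathcal{A}$ is the companion matrix of the bimonic Laurent polynomial $$\Big(2k+2-\sum_{r=1}^{k}(z^{s_{1,r}}+z^{ -s_{1,r}})\Big)\Big(2l+2-\sum_{r=1}^{l}(z^{s_{2,r}}+z^{ -s_{2,r}})\Big)-1$$ and $I$ is the identity matrix of the same size as $\mathcal{A}$.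
   Context: The circulant graph $C_n(s_1,\ldots,s_k)$ has vertices $0,\ldots,n-1$, with vertex $i$ adjacent to $i\pm s_1,\ldots,i\pm s_k \pmod n$. The cobordism of two circulant graphs $C_1,C_2$ on the same vertex labels $0,\ldots,n-1$ is the graph obtained from the disjoint union of $C_1$ and $C_2$ by joining vertex $i$ of $C_1$ to vertex $i$ of $C_2$ by an edge, for each $i$. The cone over a graph $G$ is obtained by adding a new vertex joined by a single edge to every vertex of $G$. For a connected graph $H$ on $m$ vertices with Laplacian $L(H)=D(H)-A(H)$, the Jacobian $Jac(H)$ is the torsion subgroup of $\mathbb{Z}^m/\mathrm{im}\,L(H)$. For a bimonic integer Laurent polynomial $P(z)=z^{p}+a_1z^{p+1}+\ldots+a_{s-1}z^{p+s-1}+z^{p+s}$ ($s>0$), its companion matrix is the $s\times s$ integer matrix with first $s-1$ rows $(0\mid I_{s-1})$ and last row $(-1,-a_1,\ldots,-a_{s-1})$. For a square integer matrix $M$ of size $s$, $\mathrm{coker}\,M=\mathbb{Z}^s/\mathrm{im}\,M$. -}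

module Defs where

open import Data.Nat as ℕ using (ℕ; zero; suc)
open import Data.Nat.DivMod using (_%_)
open import Data.Integer as ℤ using (ℤ; +_; -_)
open import Data.Fin as Fin using (Fin; toℕ; splitAt)
open import Data.Bool using (Bool; true; false; _∨_; if_then_else_)
open import Data.Unit using (⊤; tt)
open import Data.Sum using (_⊎_; inj₁; inj₂)
open import Data.Product using (Σ; _×_; _,_; ∃)
open import Relation.Nullary using (does)
open import Relation.Binary.PropositionalEquality using (_≡_)

sumFin : (m : ℕ) → (Fin m → ℤ) → ℤ
sumFin zero    f = + 0
sumFin (suc m) f = f Fin.zero ℤ.+ sumFin m (λ i → f (Fin.suc i))

anyFin : (m : ℕ) → (Fin m → Bool) → Bool
anyFin zero    f = false
anyFin (suc m) f = f Fin.zero ∨ anyFin m (λ i → f (Fin.suc i))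

sumRange : ℤ → ℕ → (ℤ → ℤ) → ℤ
sumRange lo zero    f = + 0
sumRange lo (suc c) f = f lo ℤ.+ sumRange (lo ℤ.+ + 1) c f

bool→ℤ : Bool → ℤ
bool→ℤ true  = + 1
bool→ℤ false = + 0

Vect : ℕ → Set
Vect m = Fin m → ℤ

Mat : ℕ → ℕ → Set
Mat a b = Fin a → Fin b → ℤ

_·v_ : ∀ {a b} → Mat a b → Vect b → Vect a
_·v_ {b = b} M x i = sumFin b (λ j → M i j ℤ.* x j)

_+v_ : ∀ {m} → Vect m → Vect m → Vect m
(x +v y) i = x i ℤ.+ y i

_-v_ : ∀ {m} → Vect m → Vect m → Vect m
(x -v y) i = x i ℤ.- y i

_*v_ : ∀ {m} → ℕ → Vect m → Vect m
(c *v x) i = + c ℤ.* x i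

_·_ : ∀ {a b c} → Mat a b → Mat b c → Mat a c
_·_ {b = b} M N i j = sumFin b (λ t → M i t ℤ.* N t j)

idMat : ∀ {s} → Mat s s
idMat i j = if does (i Fin.≟ j) then + 1 else + 0

_-M_ : ∀ {a b} → Mat a b → Mat a b → Mat a b
(M -M N) i j = M i j ℤ.- N i j

_^M_ : ∀ {s} → Mat s s → ℕ → Mat s s
M ^M zero  = idMat
M ^M suc e = M · (M ^M e)

InIm : ∀ {a b} → Mat a b → Vect a → Set
InIm {b = b} M x = ∃ λ (y : Vect b) → ∀ i → (M ·v y) i ≡ x i

-- equality in coker M = Z^a / im M
_≈[_]_ : ∀ {a b} → Vect a → Mat a b → Vect a → Set
x ≈[ M ] y = InIm M (x -v y)

Torsion : ∀ {a b} → Mat a b → Vect a → Set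
Torsion M x = Σ ℕ λ c → (1 ℕ.≤ c) × InIm M (c *v x)

-- A group isomorphism  (torsion subgroup of coker L)  ≅  coker K,
-- given by a map on representatives.
record TorsCokerIso {m s : ℕ} (L : Mat m m) (K : Mat s s) : Set where
  field
    f    : Vect m → Vect s
    wd   : ∀ x y → Torsion L x → Torsion L y → x ≈[ L ] y → f x ≈[ K ] f y
    hom  : ∀ x y → Torsion L x → Torsion L y → f (x +v y) ≈[ K ] (f x +v f y)
    inj  : ∀ x y → Torsion L x → Torsion L y → f x ≈[ K ] f y → x ≈[ L ] y
    surj : ∀ z → Σ (Vect m) λ x → Torsion L x × (f x ≈[ K ] z)

-- Graphs on Fin m given by a (symmetric, loopless) adjacency relation

laplacian : ∀ {m} → (Fin m → Fin m → Bool) → Mat m m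
laplacian {m} A i j =
  (if does (i Fin.≟ j) then sumFin m (λ t → bool→ℤ (A i t)) else + 0)
  ℤ.- bool→ℤ (A i j)

-- Jac(H) ≅ coker K  (Jac(H) = torsion subgroup of Z^m / im L(H))
JacIso : ∀ {m s} → (Fin m → Fin m → Bool) → Mat s s → Set
JacIso A K = TorsCokerIso (laplacian A) K

circAdj : ∀ {k} (n : ℕ) → (Fin k → ℕ) → Fin n → Fin n → Bool
circAdj zero    st () b
circAdj {k} (suc n') st a b =
  anyFin k (λ r → does (toℕ b ℕ.≟ (toℕ a ℕ.+ st r) % suc n')
                ∨ does (toℕ a ℕ.≟ (toℕ b ℕ.+ st r) % suc n'))

-- vertices of the cone over the cobordism: 0 = apex,
-- 1 + i (i < n) = vertex i of C_1,  1 + n + i = vertex i of C_2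
ConeVertex : ℕ → Set
ConeVertex n = ⊤ ⊎ (Fin n ⊎ Fin n)

coneView : ∀ n → Fin (suc (n ℕ.+ n)) → ConeVertex n
coneView n Fin.zero    = inj₁ tt
coneView n (Fin.suc i) = inj₂ (splitAt n i)

coneAdjV : ∀ {k l} n → (Fin k → ℕ) → (Fin l → ℕ) → ConeVertex n → ConeVertex n → Bool
coneAdjV n s₁ s₂ (inj₁ _) (inj₁ _) = false
coneAdjV n s₁ s₂ (inj₁ _) (inj₂ _) = true
coneAdjV n s₁ s₂ (inj₂ _) (inj₁ _) = true
coneAdjV n s₁ s₂ (inj₂ (inj₁ a)) (inj₂ (inj₁ b)) = circAdj n s₁ a b
coneAdjV n s₁ s₂ (inj₂ (inj₂ a)) (inj₂ (inj₂ b)) = circAdj n s₂ a b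
coneAdjV n s₁ s₂ (inj₂ (inj₁ a)) (inj₂ (inj₂ b)) = does (a Fin.≟ b)
coneAdjV n s₁ s₂ (inj₂ (inj₂ a)) (inj₂ (inj₁ b)) = does (a Fin.≟ b)

coneCobAdj : ∀ {k l} n → (Fin k → ℕ) → (Fin l → ℕ) →
             Fin (suc (n ℕ.+ n)) → Fin (suc (n ℕ.+ n)) → Bool
coneCobAdj n s₁ s₂ u v = coneAdjV n s₁ s₂ (coneView n u) (coneView n v)

ValidSteps : ∀ {k} → ℕ → (Fin k → ℕ) → Set
ValidSteps n st =
  (∀ r → 1 ℕ.≤ st r) × (∀ r → 2 ℕ.* st r ℕ.< n) × (∀ r t → r Fin.< t → st r ℕ.< st t)

-- Integer Laurent polynomials: coefficient function with support in
-- [-bound, bound] (the bound is only used to compute products).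

record LPoly : Set where
  field
    bound : ℕ
    coeff : ℤ → ℤ
open LPoly public

constLP : ℤ → LPoly
constLP c = record { bound = 0 ; coeff = λ e → if does (e ℤ.≟ + 0) then c else + 0 }

monoLP : ℤ → LPoly
monoLP a = record { bound = ℤ.∣ a ∣ ; coeff = λ e → if does (e ℤ.≟ a) then + 1 else + 0 }

_+LP_ : LPoly → LPoly → LPoly
P +LP Q = record { bound = bound P ℕ.⊔ bound Q ; coeff = λ e → coeff P e ℤ.+ coeff Q e }

_-LP_ : LPoly → LPoly → LPoly
P -LP Q = record { bound = bound P ℕ.⊔ bound Q ; coeff = λ e → coeff P e ℤ.- coeff Q e }

_*LP_ : LPoly → LPoly → LPoly
P *LP Q = record
  { bound = bound P ℕ.+ bound Q
  ; coeff = λ e → sumRange (- (+ bound P)) (suc (2 ℕ.* bound P))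
                           (λ i → coeff P i ℤ.* coeff Q (e ℤ.- i)) }

sumLP : (m : ℕ) → (Fin m → LPoly) → LPoly
sumLP zero    f = constLP (+ 0)
sumLP (suc m) f = f Fin.zero +LP sumLP m (λ i → f (Fin.suc i))

factorLP : (k : ℕ) → (Fin k → ℕ) → LPoly
factorLP k st =
  constLP (+ (2 ℕ.* k ℕ.+ 2)) -LP sumLP k (λ r → monoLP (+ st r) +LP monoLP (- (+ st r)))

thePoly : (k l : ℕ) → (Fin k → ℕ) → (Fin l → ℕ) → LPoly
thePoly k l s₁ s₂ = (factorLP k s₁ *LP factorLP l s₂) -LP constLP (+ 1)

Bimonic : LPoly → ℤ → ℕ → Set
Bimonic P p s =
  (1 ℕ.≤ s) × (coeff P p ≡ + 1) × (coeff P (p ℤ.+ + s) ≡ + 1) ×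
  (∀ e → (e ℤ.< p) ⊎ (p ℤ.+ + s ℤ.< e) → coeff P e ≡ + 0)

companion : LPoly → ℤ → (s : ℕ) → Mat s s
companion P p s i j =
  if does (suc (toℕ i) ℕ.<? s)
  then (if does (toℕ j ℕ.≟ suc (toℕ i)) then + 1 else + 0)
  else (if does (toℕ j ℕ.≟ 0) then - (+ 1) else - coeff P (p ℤ.+ + toℕ j))

-- Every non-apex vertex of the cone is adjacent to the apex, so the reduced Laplacian L₀ (apex row and
-- column deleted) is strictly diagonally dominant and coker L₀ is finite; the torsion classes of
-- coker L are those with coordinate sum 0, and they correspond to coker L₀. For the cobordism,
-- L₀ = [[F₁, -I], [-I, F₂]] with Fᵢ = (2kᵢ + 2) - A(Cᵢ), and eliminating one block gives
-- coker L₀ ≅ coker (F₁ F₂ - I). Reading vectors of ℤⁿ as n-periodic sequences, Fᵢ acts as its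
-- Laurent factor in the shift, so F₁ F₂ - I acts as the polynomial P of the theorem.
--
-- On all sequences ℕ → ℤ let α = z^(-p) P(z) and β = zⁿ - 1, z the shift. They commute and both are
-- onto, so a snake-lemma argument gives coker (α on ker β) ≅ coker (β on ker α). Here ker β is the
-- n-periodic sequences, while ker α ≅ ℤˢ through windows of s consecutive terms (P is bimonic), on
-- which the shift is the companion matrix 𝒜 and β is 𝒜ⁿ - I.

module Submission where

open import Defs
open import Data.Nat as ℕ using (ℕ; zero; suc; s≤s; z≤n; _≤_; _<_; _%_; _/_; _∸_; _⊔_; NonZero)
import Data.Nat.Properties as ℕP
open import Data.Nat.DivMod
  using (m%n<n; m<n⇒m%n≡m; [m+n]%n≡m%n; [m+kn]%n≡m%n; m≡m%n+[m/n]*n; m/n≡1+[m∸n]/n; m%n≡m∸m/n*n; m/n*n≤m; %-distribˡ-+; m%n%n≡m%n; m≤n⇒[n∸m]%m≡n%m)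
open import Data.Integer as ℤ using (ℤ; +_; -_; -[1+_]; _+_; _*_; _-_; ∣_∣)
import Data.Integer.Properties as ℤP
open import Data.Integer.Tactic.RingSolver using (solve-∀)
open import Data.Fin as Fin using (Fin; toℕ; fromℕ<; _↑ˡ_; _↑ʳ_; splitAt)
import Data.Fin.Properties as FinP
open import Data.Fin.Properties using (toℕ-injective; toℕ-fromℕ<; toℕ<n; toℕ-inject₁; toℕ-fromℕ; fromℕ<-toℕ; fromℕ<-cong; splitAt-↑ˡ; splitAt-↑ʳ; splitAt⁻¹-↑ˡ; splitAt⁻¹-↑ʳ)
open import Data.Bool using (Bool; true; false; _∨_; if_then_else_)
open import Data.Bool.Properties using (∨-comm)
open import Data.Sum using (_⊎_; inj₁; inj₂)
open import Data.Product using (Σ; _×_; _,_; proj₁; proj₂)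
open import Data.Empty using (⊥; ⊥-elim)
open import Relation.Nullary using (Dec; ¬_; yes; no; does)
open import Relation.Nullary.Decidable using (dec-true; dec-false)
open import Relation.Binary.PropositionalEquality
open import Relation.Binary.Definitions using (tri<; tri≈; tri>)

sumFin-cong : ∀ m {f g : Fin m → ℤ} → (∀ i → f i ≡ g i) → sumFin m f ≡ sumFin m g
sumFin-cong zero eq = refl
sumFin-cong (suc m) eq = cong₂ _+_ (eq Fin.zero) (sumFin-cong m (λ i → eq (Fin.suc i)))

sumFin-add : ∀ m (f g : Fin m → ℤ) → sumFin m (λ i → f i + g i) ≡ sumFin m f + sumFin m g
sumFin-add zero f g = refl
sumFin-add (suc m) f g rewrite sumFin-add m (λ i → f (Fin.suc i)) (λ i → g (Fin.suc i)) =
  rearrange (f Fin.zero) (g Fin.zero) (sumFin m (λ i → f (Fin.suc i))) (sumFin m (λ i → g (Fin.suc i)))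
  where
  rearrange : ∀ a b c d → a + b + (c + d) ≡ a + c + (b + d)
  rearrange = solve-∀

sumFin-zero : ∀ m {f : Fin m → ℤ} → (∀ i → f i ≡ + 0) → sumFin m f ≡ + 0
sumFin-zero zero eq = refl
sumFin-zero (suc m) eq rewrite eq Fin.zero | sumFin-zero m (λ i → eq (Fin.suc i)) = refl

sumFin-*ˡ : ∀ m c (f : Fin m → ℤ) → sumFin m (λ i → c * f i) ≡ c * sumFin m f
sumFin-*ˡ zero c f = sym (ℤP.*-zeroʳ c)
sumFin-*ˡ (suc m) c f rewrite sumFin-*ˡ m c (λ i → f (Fin.suc i)) =
  sym (ℤP.*-distribˡ-+ c (f Fin.zero) _)

sumFin-neg : ∀ m (f : Fin m → ℤ) → sumFin m (λ i → - f i) ≡ - sumFin m f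
sumFin-neg zero f = refl
sumFin-neg (suc m) f rewrite sumFin-neg m (λ i → f (Fin.suc i)) =
  sym (ℤP.neg-distrib-+ (f Fin.zero) _)

sumFin-sub : ∀ m (f g : Fin m → ℤ) → sumFin m (λ i → f i - g i) ≡ sumFin m f - sumFin m g
sumFin-sub m f g = trans (sumFin-add m f (λ i → - g i)) (cong (_+_ (sumFin m f)) (sumFin-neg m g))

sumFin-swap : ∀ a b (f : Fin a → Fin b → ℤ) →
  sumFin a (λ i → sumFin b (λ j → f i j)) ≡ sumFin b (λ j → sumFin a (λ i → f i j))
sumFin-swap zero b f = sym (sumFin-zero b (λ _ → refl))
sumFin-swap (suc a) b f =
  trans (cong (_+_ (sumFin b (f Fin.zero))) (sumFin-swap a b (λ i → f (Fin.suc i))))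
        (sym (sumFin-add b (f Fin.zero) (λ j → sumFin a (λ i → f (Fin.suc i) j))))

sumFin-single : ∀ m (f : Fin m → ℤ) (i : Fin m) → (∀ j → ¬ (j ≡ i) → f j ≡ + 0) → sumFin m f ≡ f i
sumFin-single (suc m) f Fin.zero h =
  trans (cong (_+_ (f Fin.zero)) (sumFin-zero m (λ j → h (Fin.suc j) (λ ())))) (ℤP.+-identityʳ _)
sumFin-single (suc m) f (Fin.suc i) h =
  trans (cong₂ _+_ (h Fin.zero (λ ())) (sumFin-single m (λ j → f (Fin.suc j)) i
         (λ j ne → h (Fin.suc j) (λ e → ne (FinP.suc-injective e)))))
        (ℤP.+-identityˡ _)

sumFin-splitAt : ∀ a b (f : Fin (a ℕ.+ b) → ℤ) →
  sumFin (a ℕ.+ b) f ≡ sumFin a (λ i → f (i ↑ˡ b)) + sumFin b (λ i → f (a ↑ʳ i))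
sumFin-splitAt zero b f = sym (ℤP.+-identityˡ _)
sumFin-splitAt (suc a) b f rewrite sumFin-splitAt a b (λ i → f (Fin.suc i)) =
  sym (ℤP.+-assoc (f Fin.zero) _ _)

sumFin-last : ∀ m (f : Fin (suc m) → ℤ) →
  sumFin (suc m) f ≡ sumFin m (λ i → f (Fin.inject₁ i)) + f (Fin.fromℕ m)
sumFin-last zero f = trans (ℤP.+-identityʳ (f Fin.zero)) (sym (ℤP.+-identityˡ (f Fin.zero)))
sumFin-last (suc m) f rewrite sumFin-last m (λ i → f (Fin.suc i)) =
  sym (ℤP.+-assoc (f Fin.zero) _ _)

sumFin-scaledδ : ∀ m (i : Fin m) (c : ℤ) (f : Fin m → ℤ) →
  sumFin m (λ j → (if does (i Fin.≟ j) then c else + 0) * f j) ≡ c * f i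
sumFin-scaledδ m i c f = trans (sumFin-single m _ i h) e
  where
  e : (if does (i Fin.≟ i) then c else + 0) * f i ≡ c * f i
  e with i Fin.≟ i
  ... | yes _ = refl
  ... | no ne = ⊥-elim (ne refl)
  h : ∀ j → ¬ j ≡ i → (if does (i Fin.≟ j) then c else + 0) * f j ≡ + 0
  h j ne with i Fin.≟ j
  ... | yes eq = ⊥-elim (ne (sym eq))
  ... | no _ = refl

does-true⇒ : ∀ {A : Set} (d : Dec A) → does d ≡ true → A
does-true⇒ (yes a) _ = a
does-true⇒ (no _) ()

≟-true⇒≡ : ∀ x y → does (x ℕ.≟ y) ≡ true → x ≡ y
≟-true⇒≡ x y = does-true⇒ (x ℕ.≟ y)

≡⇒≟-true : ∀ x y → x ≡ y → does (x ℕ.≟ y) ≡ true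
≡⇒≟-true x y = dec-true (x ℕ.≟ y)

bool→ℤ-≢true : ∀ {b} → ¬ (b ≡ true) → bool→ℤ b ≡ + 0
bool→ℤ-≢true {true} b≢true = ⊥-elim (b≢true refl)
bool→ℤ-≢true {false} _ = refl

bool→ℤ≡0⇒false : ∀ {b} → bool→ℤ b ≡ + 0 → b ≡ false
bool→ℤ≡0⇒false {false} _ = refl

sumFin-unique-support : ∀ m (P : Fin m → Bool) (u : Fin m → ℤ) (b₀ : Fin m) →
  (∀ b → P b ≡ true → b ≡ b₀) → P b₀ ≡ true → sumFin m (λ b → bool→ℤ (P b) * u b) ≡ u b₀
sumFin-unique-support m P u b₀ unique Pb₀ =
  trans (sumFin-single m _ b₀ (λ b b≢b₀ → cong (_* u b) (bool→ℤ-≢true (λ Pb → b≢b₀ (unique b Pb)))))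
        (trans (cong (λ v → bool→ℤ v * u b₀) Pb₀) (ℤP.*-identityˡ (u b₀)))

sumFin-silent : ∀ k (X Y : Fin k → Bool) → (∀ r → ¬ (X r ≡ true)) → (∀ r → ¬ (Y r ≡ true)) →
  sumFin k (λ r → bool→ℤ (X r) + bool→ℤ (Y r)) ≡ + 0
sumFin-silent k X Y ¬X ¬Y = sumFin-zero k (λ r → cong₂ _+_ (bool→ℤ-≢true (¬X r)) (bool→ℤ-≢true (¬Y r)))

anyFin-disjoint : ∀ k (X Y : Fin k → Bool) →
  (∀ r r' → X r ≡ true → X r' ≡ true → r ≡ r') →
  (∀ r r' → Y r ≡ true → Y r' ≡ true → r ≡ r') →
  (∀ r r' → X r ≡ true → Y r' ≡ true → ⊥) →
  bool→ℤ (anyFin k (λ r → X r ∨ Y r)) ≡ sumFin k (λ r → bool→ℤ (X r) + bool→ℤ (Y r))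
anyFin-disjoint zero X Y _ _ _ = refl
anyFin-disjoint (suc k) X Y X-unique Y-unique disjoint with X Fin.zero in X₀ | Y Fin.zero in Y₀
... | true | true = ⊥-elim (disjoint _ _ X₀ Y₀)
... | true | false = sym (cong (_+_ (+ 1)) (sumFin-silent k _ _
      (λ r Xr → FinP.0≢1+n (X-unique _ _ X₀ Xr)) (λ r Yr → disjoint _ _ X₀ Yr)))
... | false | true = sym (cong (_+_ (+ 1)) (sumFin-silent k _ _
      (λ r Xr → disjoint _ _ Xr Y₀) (λ r Yr → FinP.0≢1+n (Y-unique _ _ Y₀ Yr))))
... | false | false = trans (anyFin-disjoint k (λ r → X (Fin.suc r)) (λ r → Y (Fin.suc r))
        (λ r r' a b → FinP.suc-injective (X-unique _ _ a b)) (λ r r' a b → FinP.suc-injective (Y-unique _ _ a b))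
        (λ r r' → disjoint _ _))
      (sym (ℤP.+-identityˡ _))

anyFin-cong : ∀ k (f g : Fin k → Bool) → (∀ r → f r ≡ g r) → anyFin k f ≡ anyFin k g
anyFin-cong zero f g e = refl
anyFin-cong (suc k) f g e = cong₂ _∨_ (e Fin.zero) (anyFin-cong k _ _ (λ r → e (Fin.suc r)))

bool→ℤ-if : ∀ x → bool→ℤ x ≡ (if x then + 1 else + 0)
bool→ℤ-if true = refl
bool→ℤ-if false = refl

does-≟-sym : ∀ {m} (a b : Fin m) → does (a Fin.≟ b) ≡ does (b Fin.≟ a)
does-≟-sym a b with a Fin.≟ b | b Fin.≟ a
... | yes _ | yes _ = refl
... | no _ | no _ = refl
... | yes e | no ne = ⊥-elim (ne (sym e))
... | no ne | yes e = ⊥-elim (ne (sym e))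

sumFin-δ : ∀ {m} (a : Fin m) (u : Vect m) → sumFin m (λ c → bool→ℤ (does (a Fin.≟ c)) * u c) ≡ u a
sumFin-δ {m} a u = trans (sumFin-cong m (λ c → cong (_* u c) (bool→ℤ-if (does (a Fin.≟ c)))))
  (trans (sumFin-scaledδ m a (+ 1) u) (ℤP.*-identityˡ (u a)))

_≐_ : {I : Set} → (I → ℤ) → (I → ℤ) → Set
x ≐ y = ∀ i → x i ≡ y i

infixr 5 _⟫_
_⟫_ : ∀ {I : Set} {a b c : I → ℤ} → a ≐ b → b ≐ c → a ≐ c
(p ⟫ q) i = trans (p i) (q i)

≐-sym : ∀ {I : Set} {a b : I → ℤ} → a ≐ b → b ≐ a
≐-sym p i = sym (p i)

Im : {I J : Set} → ((J → ℤ) → (I → ℤ)) → (I → ℤ) → Set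
Im {I} {J} g x = Σ (J → ℤ) λ y → ∀ i → g y i ≡ x i

record IsLinear {I J : Set} (g : (J → ℤ) → (I → ℤ)) : Set where
  field
    lin-cong : ∀ x y → x ≐ y → g x ≐ g y
    lin-+  : ∀ x y → g (λ j → x j + y j) ≐ (λ i → g x i + g y i)
open IsLinear public

module _ {I J : Set} {g : (J → ℤ) → (I → ℤ)} (L : IsLinear g) where
  lin-0 : g (λ _ → + 0) ≐ (λ _ → + 0)
  lin-0 i = doubling⇒0 (g z i) (trans (sym (lin-cong L _ _ (λ _ → refl) i)) (lin-+ L z z i))
    where
    z : J → ℤ
    z _ = + 0
    doubling⇒0 : ∀ a → a ≡ a + a → a ≡ + 0
    doubling⇒0 a e = sym (trans (sym (ℤP.+-inverseʳ a)) (trans (cong (_- a) e) (rearrange a)))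
      where rearrange : ∀ a → a + a - a ≡ a
            rearrange = solve-∀

  lin-neg : ∀ x → g (λ j → - x j) ≐ (λ i → - g x i)
  lin-neg x i = sum0⇒neg (g (λ j → - x j) i) (g x i)
    (trans (sym (lin-+ L (λ j → - x j) x i))
      (trans (lin-cong L _ _ (λ j → ℤP.+-inverseˡ (x j)) i) (lin-0 i)))
    where sum0⇒neg : ∀ a b → a + b ≡ + 0 → a ≡ - b
          sum0⇒neg a b e = trans (rearrange a b) (trans (cong (_- b) e) (ℤP.+-identityˡ (- b)))
            where rearrange : ∀ a b → a ≡ a + b - b
                  rearrange = solve-∀

  lin-sub : ∀ x y → g (λ j → x j - y j) ≐ (λ i → g x i - g y i)
  lin-sub x y i = trans (lin-+ L x (λ j → - y j) i) (cong (_+_ (g x i)) (lin-neg y i))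

  im-0 : Im g (λ _ → + 0)
  im-0 = (λ _ → + 0) , lin-0

  im-resp : ∀ x x' → x ≐ x' → Im g x → Im g x'
  im-resp x x' e (y , p) = y , λ i → trans (p i) (e i)

  im-+ : ∀ x x' → Im g x → Im g x' → Im g (λ i → x i + x' i)
  im-+ x x' (y , p) (y' , p') = (λ j → y j + y' j) , λ i → trans (lin-+ L y y' i) (cong₂ _+_ (p i) (p' i))

  im-neg : ∀ x → Im g x → Im g (λ i → - x i)
  im-neg x (y , p) = (λ j → - y j) , λ i → trans (lin-neg y i) (cong -_ (p i))

  im-sub : ∀ x x' → Im g x → Im g x' → Im g (λ i → x i - x' i)
  im-sub x x' a b = im-+ x (λ i → - x' i) a (im-neg x' b)

  im-self : ∀ y → Im g (g y)
  im-self y = y , λ _ → refl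

lin-∘ : {I J K : Set} {f : (J → ℤ) → (I → ℤ)} {g : (K → ℤ) → (J → ℤ)} → IsLinear f → IsLinear g → IsLinear (λ x → f (g x))
lin-∘ {f = f} {g} Lf Lg = record
  { lin-cong = λ x y e → lin-cong Lf _ _ (lin-cong Lg x y e)
  ; lin-+ = λ x y i → trans (lin-cong Lf _ _ (lin-+ Lg x y) i) (lin-+ Lf (g x) (g y) i) }

record CokerIso {I J K L : Set} (g : (J → ℤ) → (I → ℤ)) (h : (L → ℤ) → (K → ℤ)) : Set where
  field
    to : (I → ℤ) → (K → ℤ)
    from : (K → ℤ) → (I → ℤ)
    to-linear : IsLinear to
    from-linear : IsLinear from
    to-im : ∀ y → Im h (to (g y))
    from-im : ∀ y → Im g (from (h y))
    from∘to : ∀ x → Im g (λ i → from (to x) i - x i)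
    to∘from : ∀ z → Im h (λ i → to (from z) i - z i)
open CokerIso public

im-map : {I J K L : Set} {g : (J → ℤ) → (I → ℤ)} {h : (L → ℤ) → (K → ℤ)} {to : (I → ℤ) → (K → ℤ)} →
        IsLinear h → IsLinear to → (∀ y → Im h (to (g y))) → ∀ x → Im g x → Im h (to x)
im-map Lh LF fim x (y , p) = im-resp Lh _ _ (lin-cong LF _ _ p) (fim y)

cokerIso-trans : {I J K L M N : Set} {g : (J → ℤ) → (I → ℤ)} {h : (L → ℤ) → (K → ℤ)} {k : (N → ℤ) → (M → ℤ)} →
   IsLinear g → IsLinear k → CokerIso g h → CokerIso h k → CokerIso g k
cokerIso-trans {g = g} {h} {k} Lg Lk c d = record
  { to = λ x → to d (to c x)
  ; from = λ z → from c (from d z)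
  ; to-linear = lin-∘ (to-linear d) (to-linear c)
  ; from-linear = lin-∘ (from-linear c) (from-linear d)
  ; to-im = λ y → im-map Lk (to-linear d) (to-im d) _ (to-im c y)
  ; from-im = λ y → im-map Lg (from-linear c) (from-im c) _ (from-im d y)
  ; from∘to = gf
  ; to∘from = fg
  }
  where
  rearrange : ∀ a b c → a - b + (b - c) ≡ a - c
  rearrange = solve-∀
  gf : ∀ x → Im g (λ i → from c (from d (to d (to c x))) i - x i)
  gf x = im-resp Lg _ _ (λ i → rearrange (from c u i) (from c v i) (x i))
       (im-+ Lg _ _ (im-resp Lg _ _ (lin-sub (from-linear c) u v) (im-map Lg (from-linear c) (from-im c) _ (from∘to d (to c x)))) (from∘to c x))
    where u = from d (to d (to c x))
          v = to c x
  fg : ∀ z → Im k (λ i → to d (to c (from c (from d z))) i - z i)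
  fg z = im-resp Lk _ _ (λ i → rearrange (to d u i) (to d v i) (z i))
       (im-+ Lk _ _ (im-resp Lk _ _ (lin-sub (to-linear d) u v) (im-map Lk (to-linear d) (to-im d) _ (to∘from c (from d z)))) (to∘from d z))
    where u = to c (from c (from d z))
          v = from d z

cokerIso-resp : {I J K L : Set} {g : (J → ℤ) → (I → ℤ)} {h h' : (L → ℤ) → (K → ℤ)} →
  (∀ y → h y ≐ h' y) → CokerIso g h → CokerIso g h'
cokerIso-resp {h = h} {h'} e c = record
  { to = to c ; from = from c ; to-linear = to-linear c ; from-linear = from-linear c
  ; to-im = λ y → tr (to-im c y)
  ; from-im = λ y → let w = from-im c y in proj₁ w , λ i → trans (proj₂ w i) (lin-cong (from-linear c) _ _ (e y) i)
  ; from∘to = from∘to c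
  ; to∘from = λ z → tr (to∘from c z) }
  where
  tr : ∀ {x} → Im h x → Im h' x
  tr (y , p) = y , λ i → trans (sym (e y i)) (p i)

cokerIso-refl : ∀ {I J : Set} {g : (J → ℤ) → (I → ℤ)} → IsLinear g → CokerIso g g
cokerIso-refl {g = g} L = record
  { to = λ x → x ; from = λ x → x
  ; to-linear = record { lin-cong = λ x y e → e ; lin-+ = λ x y i → refl }
  ; from-linear = record { lin-cong = λ x y e → e ; lin-+ = λ x y i → refl }
  ; to-im = im-self L ; from-im = im-self L
  ; from∘to = λ x → im-resp L _ _ (λ i → sym (ℤP.+-inverseʳ (x i))) (im-0 L)
  ; to∘from = λ x → im-resp L _ _ (λ i → sym (ℤP.+-inverseʳ (x i))) (im-0 L) }

·v-linear : ∀ {a b} (M : Mat a b) → IsLinear (M ·v_)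
·v-linear {a} {b} M = record
  { lin-cong = λ x y e i → sumFin-cong b (λ j → cong (M i j *_) (e j))
  ; lin-+ = λ x y i → trans (sumFin-cong b (λ j → ℤP.*-distribˡ-+ (M i j) (x j) (y j)))
                           (sumFin-add b (λ j → M i j * x j) (λ j → M i j * y j)) }

·-·v-assoc : ∀ {a b c} (M : Mat a b) (N : Mat b c) (y : Vect c) → ((M · N) ·v y) ≐ (M ·v (N ·v y))
·-·v-assoc {a} {b} {c} M N y i =
  begin
    sumFin c (λ j → sumFin b (λ t → M i t * N t j) * y j)
  ≡⟨ sumFin-cong c (λ j → trans (ℤP.*-comm _ (y j)) (sym (sumFin-*ˡ b (y j) _))) ⟩
    sumFin c (λ j → sumFin b (λ t → y j * (M i t * N t j)))
  ≡⟨ sumFin-swap c b _ ⟩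
    sumFin b (λ t → sumFin c (λ j → y j * (M i t * N t j)))
  ≡⟨ sumFin-cong b (λ t → trans (sumFin-cong c (λ j → rearrange (y j) (M i t) (N t j))) (sumFin-*ˡ c (M i t) _)) ⟩
    sumFin b (λ t → M i t * sumFin c (λ j → N t j * y j))
  ∎
  where open ≡-Reasoning
        rearrange : ∀ a b c → a * (b * c) ≡ b * (c * a)
        rearrange = solve-∀

idMat-·v : ∀ {s} (y : Vect s) → (idMat ·v y) ≐ y
idMat-·v {s} y i = trans (sumFin-single s _ i h) e
  where
  e : (if does (i Fin.≟ i) then + 1 else + 0) * y i ≡ y i
  e with i Fin.≟ i
  ... | yes _ = ℤP.*-identityˡ (y i)
  ... | no ne = ⊥-elim (ne refl)
  h : ∀ j → ¬ j ≡ i → (if does (i Fin.≟ j) then + 1 else + 0) * y j ≡ + 0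
  h j ne with i Fin.≟ j
  ... | yes eq = ⊥-elim (ne (sym eq))
  ... | no _ = refl

-M-·v : ∀ {a b} (M N : Mat a b) (y : Vect b) → ((M -M N) ·v y) ≐ (λ i → (M ·v y) i - (N ·v y) i)
-M-·v {a} {b} M N y i = trans (sumFin-cong b (λ j → ℤP.*-distribʳ-+ (y j) (M i j) (- N i j)))
  (trans (sumFin-add b _ _) (cong (_+_ ((M ·v y) i))
    (trans (sumFin-cong b (λ j → sym (ℤP.neg-distribˡ-* (N i j) (y j)))) (sumFin-neg b _))))

iter : ∀ {A : Set} → (A → A) → ℕ → A → A
iter f zero x = x
iter f (suc e) x = f (iter f e x)

^M-·v : ∀ {s} (M : Mat s s) (e : ℕ) (y : Vect s) → ((M ^M e) ·v y) ≐ iter (M ·v_) e y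
^M-·v M zero y = idMat-·v y
^M-·v M (suc e) y i = trans (·-·v-assoc M (M ^M e) y i) (lin-cong (·v-linear M) _ _ (^M-·v M e y) i)

diagMinus-linear : ∀ {m} (D : ℤ) (M : Mat m m) → IsLinear (λ u a → D * u a - (M ·v u) a)
diagMinus-linear D M = record
  { lin-cong = λ x y e a → cong₂ _-_ (cong (D *_) (e a)) (lin-cong (·v-linear M) x y e a)
  ; lin-+ = λ x y a → trans (cong₂ _-_ (ℤP.*-distribˡ-+ D (x a) (y a)) (lin-+ (·v-linear M) x y a)) (rearrange (D * x a) (D * y a) ((M ·v x) a) ((M ·v y) a)) }
  where rearrange : ∀ a b c d → a + b - (c + d) ≡ (a - c) + (b - d)
        rearrange = solve-∀

-- i ≤ j witnessed by the natural gap j - i, so that inequalities become equations for the ring solver.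
record Le (i j : ℤ) : Set where
  constructor le
  field
    gap : ℕ
    gap-eq : j ≡ i + + gap

Le-refl : ∀ i → Le i i
Le-refl i = le 0 (sym (ℤP.+-identityʳ i))

Le-trans : ∀ {i j k} → Le i j → Le j k → Le i k
Le-trans {i} {j} {k} (le d p) (le d' q) = le (d ℕ.+ d') (trans q (trans (cong (_+ + d') p) (ℤP.+-assoc i (+ d) (+ d'))))

≤⇒Le : ∀ {i j} → i ℤ.≤ j → Le i j
≤⇒Le {i} {j} l = le ℤ.∣ j - i ∣ (trans (rearrange j i) (cong (_+_ i) (sym (ℤP.0≤i⇒+∣i∣≡i (ℤP.i≤j⇒0≤j-i l)))))
  where rearrange : ∀ j i → j ≡ i + (j - i)
        rearrange = solve-∀

Le⇒≤ : ∀ {i j} → Le i j → i ℤ.≤ j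
Le⇒≤ {i} (le d p) = subst (i ℤ.≤_) (sym p) (ℤP.i≤i+j i (+ d))

<⇒Le-suc : ∀ {i j} → i ℤ.< j → Le (i + + 1) j
<⇒Le-suc {i} lt = subst (λ z → Le z _) (ℤP.+-comm (+ 1) i) (≤⇒Le (ℤP.i<j⇒suc[i]≤j lt))

Le-suc⇒< : ∀ {i j} → Le (i + + 1) j → i ℤ.< j
Le-suc⇒< {i} l = ℤP.suc[i]≤j⇒i<j (Le⇒≤ (subst (λ z → Le z _) (ℤP.+-comm i (+ 1)) l))

Le-dichotomy : ∀ i j → Le (i + + 1) j ⊎ Le j i
Le-dichotomy i j with i ℤ.<? j
... | yes lt = inj₁ (<⇒Le-suc lt)
... | no nlt = inj₂ (≤⇒Le (ℤP.≮⇒≥ nlt))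

Le-irrefl-suc : ∀ i d → ¬ (i ≡ i + + 1 + + d)
Le-irrefl-suc i d e = ℕP.1+n≢0 (ℤP.+-injective 1+d≡0)
  where
  1+d≡0 : + suc d ≡ + 0
  1+d≡0 = trans (rearrange i (+ d)) (trans (cong (_- i) (sym e)) (ℤP.+-inverseʳ i))
    where rearrange : ∀ i x → + 1 + x ≡ i + + 1 + x - i
          rearrange = solve-∀

abs : ℤ → ℤ
abs x = + ∣ x ∣

Le-add : ∀ {a b c d} → Le a b → Le c d → Le (a + c) (b + d)
Le-add {a} {b} {c} {d} (le x p) (le y q) = le (x ℕ.+ y) (trans (cong₂ _+_ p q) (rearrange a c (+ x) (+ y)))
  where rearrange : ∀ a c x y → a + x + (c + y) ≡ a + c + (x + y)
        rearrange = solve-∀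

Le-0-abs : ∀ x → Le (+ 0) (abs x)
Le-0-abs x = le ∣ x ∣ refl

Le-abs : ∀ x → Le x (abs x)
Le-abs (+ m) = Le-refl _
Le-abs -[1+ m ] = le (suc m ℕ.+ suc m) (rearrange (+ m))
  where rearrange : ∀ m → + 1 + m ≡ - (+ 1 + m) + ((+ 1 + m) + (+ 1 + m))
        rearrange = solve-∀

abs-sub : ∀ x y → Le (abs (x - y)) (abs x + abs y)
abs-sub x y = ≤⇒Le (ℤ.+≤+ (ℤP.∣i-j∣≤∣i∣+∣j∣ x y))

abs-* : ∀ x y → abs (x * y) ≡ abs x * abs y
abs-* x y = trans (cong +_ (ℤP.∣i*j∣≡∣i∣*∣j∣ x y)) (ℤP.pos-* ∣ x ∣ ∣ y ∣)

sumFin-Le : ∀ m (f g : Fin m → ℤ) → (∀ j → Le (f j) (g j)) → Le (sumFin m f) (sumFin m g)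
sumFin-Le zero f g h = Le-refl _
sumFin-Le (suc m) f g h = Le-add (h Fin.zero) (sumFin-Le m _ _ (λ j → h (Fin.suc j)))

offDiagAbs : ∀ {m} → Mat m m → Fin m → Fin m → ℤ
offDiagAbs M i j = if does (i Fin.≟ j) then + 0 else abs (M i j)

StrictlyDiagDominant : ∀ {m} → Mat m m → Set
StrictlyDiagDominant {m} M = ∀ i → Le (sumFin m (offDiagAbs M i) + + 1) (M i i)

-- Every hypothesis is an equation with an explicit natural slack; the slack of the conclusion is an
-- explicit combination of them, and a single ring identity checks it.
schurRow-dominance : ∀ Sp S₀ S₁ T A Ab ab B d (k a : ℕ) → d ≡ + suc k → A ≡ + a →
  Le Sp (d * S₀ + A * S₁) → Le (A + S₀ + + 1) B → Le (+ 0 + T + + 1) d → Le ab (A * Ab) → S₁ + Ab ≡ T →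
  Le (Sp + + 1) (d * B - ab)
schurRow-dominance Sp S₀ S₁ T _ Ab ab B _ k a refl refl (le e₁ h₁) (le e₂ h₂) (le e₃ h₃) (le e₄ h₄) h₅ =
  le slack (ℤP.i-j≡0⇒i≡j _ _ (trans (cong (λ z → d * B - ab - (Sp + + 1 + z)) slack-≡)
    (trans (identity d B ab Sp A S₀ S₁ T Ab (+ e₁) (+ e₂) (+ e₃) (+ e₄))
      (combine _ _ _ _ _ (ℤP.i≡j⇒i-j≡0 h₂) (ℤP.i≡j⇒i-j≡0 h₄) (ℤP.i≡j⇒i-j≡0 h₁) (ℤP.i≡j⇒i-j≡0 h₅) (ℤP.i≡j⇒i-j≡0 h₃)))))
  where
  d A : ℤ
  d = + suc k
  A = + a
  slack : ℕ
  slack = a ℕ.* suc e₃ ℕ.+ e₁ ℕ.+ k ℕ.+ suc k ℕ.* e₂ ℕ.+ e₄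
  slack-≡ : + slack ≡ A * (+ 1 + + e₃) + + e₁ + (d - + 1) + d * + e₂ + + e₄
  slack-≡ = cong₂ (λ x y → x + + e₁ + + k + y + + e₄) (ℤP.pos-* a (suc e₃)) (ℤP.pos-* (suc k) e₂)
  identity : ∀ d B ab Sp A S₀ S₁ T Ab e₁ e₂ e₃ e₄ →
    d * B - ab - (Sp + + 1 + (A * (+ 1 + e₃) + e₁ + (d - + 1) + d * e₂ + e₄))
    ≡ d * (B - (A + S₀ + + 1 + e₂)) + (A * Ab - (ab + e₄)) + (d * S₀ + A * S₁ - (Sp + e₁))
      - A * (S₁ + Ab - T) + A * (d - (+ 0 + T + + 1 + e₃))
  identity = solve-∀
  combine : ∀ x₁ x₂ x₃ x₄ x₅ → x₁ ≡ + 0 → x₂ ≡ + 0 → x₃ ≡ + 0 → x₄ ≡ + 0 → x₅ ≡ + 0 →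
    d * x₁ + x₂ + x₃ - A * x₄ + A * x₅ ≡ + 0
  combine _ _ _ _ _ refl refl refl refl refl = zero-form d A
    where zero-form : ∀ d A → d * + 0 + + 0 + + 0 - A * + 0 + A * + 0 ≡ + 0
          zero-form = solve-∀

-- One step of Gaussian elimination with pivot d = M₀₀: the Schur complement M' = d B - a bᵀ is again
-- strictly diagonally dominant, and a solution of M' y' = c' (d z' - a z₀) lifts to M y = d c' z.
module Elimination {m : ℕ} (M : Mat (suc m) (suc m)) where
  d : ℤ
  d = M Fin.zero Fin.zero
  a b : Fin m → ℤ
  a i = M (Fin.suc i) Fin.zero
  b j = M Fin.zero (Fin.suc j)
  B : Mat m m
  B i j = M (Fin.suc i) (Fin.suc j)
  M' : Mat m m
  M' i j = d * B i j - a i * b j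

  T : ℤ
  T = sumFin m (λ j → abs (b j))

  first-row : StrictlyDiagDominant M → Le (+ 0 + T + + 1) d
  first-row sdd = sdd Fin.zero

  T-nonneg : Le (+ 0) T
  T-nonneg = subst (λ z → Le z T) (sumFin-zero m (λ _ → refl)) (sumFin-Le m (λ _ → + 0) (λ j → abs (b j)) (λ j → Le-0-abs (b j)))

  pivot-positive : StrictlyDiagDominant M → Σ ℕ λ k → d ≡ + suc k
  pivot-positive sdd with Le-trans (Le-add (Le-add (Le-refl (+ 0)) T-nonneg) (Le-refl (+ 1))) (first-row sdd)
  ... | le x p = x , p

  schur-SDD : StrictlyDiagDominant M → StrictlyDiagDominant M'
  schur-SDD sdd i = schurRow-dominance Sp S0 S1 T (abs (a i)) (abs (b i)) (a i * b i) (B i i) d k ∣ a i ∣ dk refl offDiag-sum-bound (sdd (Fin.suc i)) (first-row sdd) diag-product-bound T-split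
    where
    k = proj₁ (pivot-positive sdd)
    dk = proj₂ (pivot-positive sdd)
    Sp = sumFin m (offDiagAbs M' i)
    S0 = sumFin m (offDiagAbs B i)
    offDiagAbs-b : Fin m → ℤ
    offDiagAbs-b j = if does (i Fin.≟ j) then + 0 else abs (b j)
    S1 = sumFin m offDiagAbs-b
    abs-pivot : abs d ≡ d
    abs-pivot = trans (cong abs dk) (sym dk)
    offDiag-bound : ∀ j → Le (offDiagAbs M' i j) (d * offDiagAbs B i j + abs (a i) * offDiagAbs-b j)
    offDiag-bound j with does (i Fin.≟ j)
    ... | true = subst (Le (+ 0)) (sym (rearrange d (abs (a i)))) (Le-refl (+ 0))
      where rearrange : ∀ x y → x * + 0 + y * + 0 ≡ + 0
            rearrange = solve-∀
    ... | false = subst (Le (abs (d * B i j - a i * b j)))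
                    (cong₂ _+_ (trans (abs-* d (B i j)) (cong (_* abs (B i j)) abs-pivot)) (abs-* (a i) (b j)))
                    (abs-sub (d * B i j) (a i * b j))
    offDiag-sum-bound : Le Sp (d * S0 + abs (a i) * S1)
    offDiag-sum-bound = subst (Le Sp) (trans (sumFin-add m (λ j → d * offDiagAbs B i j) (λ j → abs (a i) * offDiagAbs-b j))
                         (cong₂ _+_ (sumFin-*ˡ m d (offDiagAbs B i)) (sumFin-*ˡ m (abs (a i)) offDiagAbs-b)))
           (sumFin-Le m (offDiagAbs M' i) _ offDiag-bound)
    diag-product-bound : Le (a i * b i) (abs (a i) * abs (b i))
    diag-product-bound = subst (Le (a i * b i)) (abs-* (a i) (b i)) (Le-abs (a i * b i))
    split-entry : ∀ j → offDiagAbs-b j + (if does (i Fin.≟ j) then + 1 else + 0) * abs (b j) ≡ abs (b j)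
    split-entry j with does (i Fin.≟ j)
    ... | true = trans (ℤP.+-identityˡ _) (ℤP.*-identityˡ _)
    ... | false = ℤP.+-identityʳ _
    T-split : S1 + abs (b i) ≡ T
    T-split = trans (cong (_+_ S1) (sym (trans (sumFin-scaledδ m i (+ 1) (λ j → abs (b j))) (ℤP.*-identityˡ _))))
           (trans (sym (sumFin-add m offDiagAbs-b (λ j → (if does (i Fin.≟ j) then + 1 else + 0) * abs (b j)))) (sumFin-cong m split-entry))

  M'-·v : ∀ (y : Vect m) i → (M' ·v y) i ≡ d * sumFin m (λ j → B i j * y j) - a i * sumFin m (λ j → b j * y j)
  M'-·v y i = trans (sumFin-cong m {g = λ j → d * (B i j * y j) + - (a i * (b j * y j))} (λ j → rearrange d (B i j) (a i) (b j) (y j)))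
    (trans (sumFin-add m (λ j → d * (B i j * y j)) (λ j → - (a i * (b j * y j))))
      (cong₂ _+_ (sumFin-*ˡ m d _) (trans (sumFin-neg m (λ j → a i * (b j * y j))) (cong -_ (sumFin-*ˡ m (a i) _)))))
    where rearrange : ∀ d B a b y → (d * B - a * b) * y ≡ d * (B * y) + - (a * (b * y))
          rearrange = solve-∀

  torsion-lift : StrictlyDiagDominant M → (c' : ℕ) → 1 ℕ.≤ c' → (∀ z → Im (M' ·v_) (c' *v z)) →
         Σ ℕ λ c → 1 ℕ.≤ c × (∀ z → Im (M ·v_) (c *v z))
  torsion-lift sdd (suc c'') _ solve = suc k ℕ.* c' , 1≤dc' , λ z → lifted z
    where
    c' = suc c''
    k = proj₁ (pivot-positive sdd)
    dk = proj₂ (pivot-positive sdd)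
    1≤dc' : 1 ℕ.≤ suc k ℕ.* c'
    1≤dc' = s≤s z≤n
    dc'≡d*c' : + (suc k ℕ.* c') ≡ d * + c'
    dc'≡d*c' = trans (ℤP.pos-* (suc k) c') (cong (_* + c') (sym dk))
    lifted : ∀ z → Im (M ·v_) ((suc k ℕ.* c') *v z)
    lifted z = y , lifted-eq
      where
      z0 = z Fin.zero
      reduced-rhs : Vect m
      reduced-rhs i = d * z (Fin.suc i) - a i * z0
      y' = proj₁ (solve reduced-rhs)
      y'-solves : ∀ i → (M' ·v y') i ≡ + c' * reduced-rhs i
      y'-solves = proj₂ (solve reduced-rhs)
      Sb = sumFin m (λ j → b j * y' j)
      SB : Fin m → ℤ
      SB i = sumFin m (λ j → B i j * y' j)
      y : Vect (suc m)
      y Fin.zero = + c' * z0 - Sb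
      y (Fin.suc j) = d * y' j
      sum-scale-d : ∀ (f : Fin m → ℤ) → sumFin m (λ j → f j * (d * y' j)) ≡ d * sumFin m (λ j → f j * y' j)
      sum-scale-d f = trans (sumFin-cong m (λ j → rearrange (f j) d (y' j))) (sumFin-*ˡ m d _)
        where rearrange : ∀ f d y → f * (d * y) ≡ d * (f * y)
              rearrange = solve-∀
      lifted-eq : ∀ i → (M ·v y) i ≡ + (suc k ℕ.* c') * z i
      lifted-eq Fin.zero = trans (cong (_+_ (d * y Fin.zero)) (sum-scale-d b))
        (trans (rearrange′ d (+ c') z0 Sb) (cong (_* z0) (sym dc'≡d*c')))
        where rearrange′ : ∀ d c z s → d * (c * z - s) + d * s ≡ d * c * z
              rearrange′ = solve-∀
      lifted-eq (Fin.suc i) = trans (cong (_+_ (a i * y Fin.zero)) (sum-scale-d (B i)))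
        (trans (cancel-d (ℤP.i-j≡0⇒i≡j _ _ (trans (rearrange″ d (a i) (+ c') z0 Sb (SB i) (z (Fin.suc i)))
                 (trans (cong (d *_) (ℤP.i≡j⇒i-j≡0 (trans (sym (M'-·v y' i)) (y'-solves i)))) (ℤP.*-zeroʳ d)))))
          (cong (_* z (Fin.suc i)) (sym dc'≡d*c')))
        where
        rearrange″ : ∀ d a c z0 sb sB z → d * (a * (c * z0 - sb) + d * sB) - d * (d * c * z)
                               ≡ d * (d * sB - a * sb - c * (d * z - a * z0))
        rearrange″ = solve-∀
        cancel-d : ∀ {x y} → d * x ≡ d * y → x ≡ y
        cancel-d {x} {y} h = ℤP.*-cancelˡ-≡ (+ suc k) x y (subst (λ gap → gap * x ≡ gap * y) dk h)

SDD⇒torsion : ∀ m (M : Mat m m) → StrictlyDiagDominant M → Σ ℕ λ c → 1 ℕ.≤ c × (∀ z → Im (M ·v_) (c *v z))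
SDD⇒torsion zero M _ = 1 , s≤s z≤n , λ z → (λ ()) , λ ()
SDD⇒torsion (suc m) M sdd = Elimination.torsion-lift M sdd (proj₁ r) (proj₁ (proj₂ r)) (proj₂ (proj₂ r))
  where r = SDD⇒torsion m (Elimination.M' M) (Elimination.schur-SDD M sdd)

module ConeReduction {m : ℕ} (A : Fin (suc m) → Fin (suc m) → Bool)
  (A-sym : ∀ i j → A i j ≡ A j i)
  (apex-adjacent : ∀ i → A (Fin.suc i) Fin.zero ≡ true)
  (loopless : ∀ i → A i i ≡ false) where

  L : Mat (suc m) (suc m)
  L = laplacian A

  Lred : Mat m m
  Lred i j = L (Fin.suc i) (Fin.suc j)

  dropApex : Vect (suc m) → Vect m
  dropApex x i = x (Fin.suc i)

  deg : Fin (suc m) → ℤ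
  deg i = sumFin (suc m) (λ t → bool→ℤ (A i t))

  laplacian-·v : ∀ y i → (L ·v y) i ≡ deg i * y i - sumFin (suc m) (λ j → bool→ℤ (A i j) * y j)
  laplacian-·v y i = trans (sumFin-cong (suc m) {g = λ j → I j * y j + (- B j) * y j} (λ j → ℤP.*-distribʳ-+ (y j) (I j) (- B j)))
    (trans (sumFin-add (suc m) (λ j → I j * y j) (λ j → (- B j) * y j)) (cong₂ _+_ (sumFin-scaledδ (suc m) i (deg i) y)
      (trans (sumFin-cong (suc m) {g = λ j → - (B j * y j)} (λ j → sym (ℤP.neg-distribˡ-* (B j) (y j))))
        (sumFin-neg (suc m) (λ j → B j * y j)))))
    where I B : Fin (suc m) → ℤ
          I j = if does (i Fin.≟ j) then deg i else + 0
          B j = bool→ℤ (A i j)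

  ones : ∀ {k} → Vect k
  ones _ = + 1

  laplacian-rowsum : ∀ i → (L ·v ones) i ≡ + 0
  laplacian-rowsum i = trans (laplacian-·v ones i) (trans (cong₂ _-_ (ℤP.*-identityʳ (deg i))
    (sumFin-cong (suc m) {g = λ j → bool→ℤ (A i j)} (λ j → ℤP.*-identityʳ _))) (ℤP.+-inverseʳ (deg i)))

  laplacian-sym : ∀ i j → (if does (i Fin.≟ j) then deg i else + 0) - bool→ℤ (A i j)
               ≡ (if does (j Fin.≟ i) then deg j else + 0) - bool→ℤ (A j i)
  laplacian-sym i j with i Fin.≟ j | j Fin.≟ i
  ... | yes refl | yes _ = refl
  ... | yes refl | no ne = ⊥-elim (ne refl)
  ... | no ne | yes e = ⊥-elim (ne (sym e))
  ... | no _ | no _ = cong (λ b → + 0 - bool→ℤ b) (A-sym i j)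

  laplacian-colsum : ∀ w → sumFin (suc m) (L ·v w) ≡ + 0
  laplacian-colsum w = trans (sumFin-swap (suc m) (suc m) (λ i j → L i j * w j))
    (trans (sumFin-cong (suc m) {g = λ _ → + 0} (λ j →
       trans (sumFin-cong (suc m) {g = λ i → w j * (L j i * + 1)} (λ i → trans (cong (_* w j) (laplacian-sym i j)) (rearrange (L j i) (w j))))
         (trans (sumFin-*ˡ (suc m) (w j) (λ i → L j i * + 1)) (trans (cong (w j *_) (laplacian-rowsum j)) (ℤP.*-zeroʳ (w j))))))
      (sumFin-zero (suc m) (λ _ → refl)))
    where rearrange : ∀ a b → a * b ≡ b * (a * + 1)
          rearrange = solve-∀

  laplacian-·v-suc : ∀ w i → (L ·v w) (Fin.suc i) ≡ (Lred ·v dropApex w) i - w Fin.zero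
  laplacian-·v-suc w i = trans (cong (λ a → a * w Fin.zero + (Lred ·v dropApex w) i) (cong (λ b → + 0 - bool→ℤ b) (apex-adjacent i)))
                 (rearrange (w Fin.zero) ((Lred ·v dropApex w) i))
    where rearrange : ∀ a b → (+ 0 - + 1) * a + b ≡ b - a
          rearrange = solve-∀

  Lred-ones : ∀ i → (Lred ·v ones) i ≡ + 1
  Lred-ones i = ℤP.i-j≡0⇒i≡j _ (+ 1) (trans (sym (laplacian-·v-suc ones i)) (laplacian-rowsum (Fin.suc i)))

  Lred-const : ∀ c i → (Lred ·v (λ _ → c)) i ≡ c
  Lred-const c i = trans (sumFin-cong m (λ j → rearrange (Lred i j) c))
    (trans (sumFin-*ˡ m c _) (trans (cong (c *_) (Lred-ones i)) (ℤP.*-identityʳ c)))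
    where rearrange : ∀ a b → a * b ≡ b * (a * + 1)
          rearrange = solve-∀

  im-dropApex : ∀ x → Im (L ·v_) x → Im (Lred ·v_) (dropApex x)
  im-dropApex x (w , p) = (λ j → w (Fin.suc j) - w Fin.zero) , λ i →
    trans (lin-sub (·v-linear Lred) (dropApex w) (λ _ → w Fin.zero) i)
      (trans (cong (_-_ ((Lred ·v dropApex w) i)) (Lred-const (w Fin.zero) i))
        (trans (sym (laplacian-·v-suc w i)) (p (Fin.suc i))))

  torsion⇒sum-zero : ∀ x c → 1 ℕ.≤ c → Im (L ·v_) (c *v x) → sumFin (suc m) x ≡ + 0
  torsion⇒sum-zero x (suc c) _ (w , p) =
    ℤP.*-cancelˡ-≡ (+ suc c) _ _ (trans (sym (sumFin-*ˡ (suc m) (+ suc c) x))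
      (trans (sumFin-cong (suc m) (λ i → sym (p i))) (trans (laplacian-colsum w) (sym (ℤP.*-zeroʳ (+ suc c))))))

  im-lift : ∀ d → sumFin (suc m) d ≡ + 0 → Im (Lred ·v_) (dropApex d) → Im (L ·v_) d
  im-lift d s0 (v , p) = w , q
    where
    w : Vect (suc m)
    w Fin.zero = + 0
    w (Fin.suc j) = v j
    qs : ∀ i → (L ·v w) (Fin.suc i) ≡ d (Fin.suc i)
    qs i = trans (laplacian-·v-suc w i) (trans (ℤP.+-identityʳ _) (p i))
    q : ∀ i → (L ·v w) i ≡ d i
    q (Fin.suc i) = qs i
    q Fin.zero = head-from-sums _ _ _ (laplacian-colsum w) (sumFin-cong m qs) s0
      where
      head-from-sums : ∀ a b c → a + b ≡ + 0 → b ≡ c → d Fin.zero + c ≡ + 0 → a ≡ d Fin.zero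
      head-from-sums a b _ ab≡0 refl db≡0 = begin
        a                                        ≡⟨ rearrange a b (d Fin.zero) ⟩
        (a + b) - (d Fin.zero + b) + d Fin.zero  ≡⟨ cong₂ (λ u v → u - v + d Fin.zero) ab≡0 db≡0 ⟩
        + 0 - + 0 + d Fin.zero                   ≡⟨ ℤP.+-identityˡ (d Fin.zero) ⟩
        d Fin.zero                               ∎
        where open ≡-Reasoning
              rearrange : ∀ a b x → a ≡ (a + b) - (x + b) + x
              rearrange = solve-∀

  balance : Vect m → Vect (suc m)
  balance u Fin.zero = - sumFin m u
  balance u (Fin.suc i) = u i

  balance-sum : ∀ u → sumFin (suc m) (balance u) ≡ + 0
  balance-sum u = ℤP.+-inverseˡ (sumFin m u)

  Lred-diag : ∀ i → Lred i i ≡ + 1 + sumFin m (λ j → bool→ℤ (A (Fin.suc i) (Fin.suc j)))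
  Lred-diag i = begin
    Lred i i
      ≡⟨ cong₂ (λ b x → (if b then deg (Fin.suc i) else + 0) - bool→ℤ x) (dec-true (i Fin.≟ i) refl) (loopless (Fin.suc i)) ⟩
    deg (Fin.suc i) - + 0
      ≡⟨ ℤP.+-identityʳ _ ⟩
    deg (Fin.suc i)
      ≡⟨ cong (λ b → bool→ℤ b + sumFin m (λ j → bool→ℤ (A (Fin.suc i) (Fin.suc j)))) (apex-adjacent i) ⟩
    + 1 + sumFin m (λ j → bool→ℤ (A (Fin.suc i) (Fin.suc j)))
      ∎
    where open ≡-Reasoning

  -- The apex contributes 1 to each diagonal entry but no off-diagonal entry.
  Lred-SDD : StrictlyDiagDominant Lred
  Lred-SDD i = subst (Le _) (sym (trans (Lred-diag i) (ℤP.+-comm (+ 1) (sumFin m (λ j → bool→ℤ (A (Fin.suc i) (Fin.suc j)))))))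
    (Le-add (sumFin-Le m (offDiagAbs Lred i) (λ j → bool→ℤ (A (Fin.suc i) (Fin.suc j)))
              (λ j → offDiag≤adjacency (does (i Fin.≟ j)) (deg (Fin.suc i)) (A (Fin.suc i) (Fin.suc j))))
            (Le-refl (+ 1)))
    where
    offDiag≤adjacency : ∀ b d x → Le (if b then + 0 else abs ((if b then d else + 0) - bool→ℤ x)) (bool→ℤ x)
    offDiag≤adjacency true d true = le 1 refl
    offDiag≤adjacency true d false = le 0 refl
    offDiag≤adjacency false d true = le 0 refl
    offDiag≤adjacency false d false = le 0 refl

  Lred-torsion : ∀ z → Torsion Lred z
  Lred-torsion z with SDD⇒torsion m Lred Lred-SDD
  ... | c , 1≤c , solvable = c , 1≤c , solvable z

  torsCokerIso-cone : ∀ {s} (K : Mat s s) → CokerIso (Lred ·v_) (K ·v_) → TorsCokerIso L K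
  torsCokerIso-cone K c = record
    { f = λ x → to c (dropApex x)
    ; wd = λ x y _ _ e → im-resp LK _ _ (lin-sub (to-linear c) (dropApex x) (dropApex y))
             (im-map LK (to-linear c) (to-im c) _ (im-dropApex _ e))
    ; hom = λ x y _ _ → im-resp LK _ _ (λ i → sym (ℤP.i≡j⇒i-j≡0 (lin-+ (to-linear c) (dropApex x) (dropApex y) i))) (im-0 LK)
    ; inj = inj
    ; surj = surj }
    where
    LK = ·v-linear K
    LLr = ·v-linear Lred
    tsum : ∀ x → Torsion L x → sumFin (suc m) x ≡ + 0
    tsum x (c , c1 , e) = torsion⇒sum-zero x c c1 e
    inj : ∀ x y → Torsion L x → Torsion L y → to c (dropApex x) ≈[ K ] to c (dropApex y) → x ≈[ L ] y
    inj x y tx ty e = im-lift _ (trans (sumFin-sub (suc m) x y) (trans (cong₂ _-_ (tsum x tx) (tsum y ty)) refl)) imr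
      where
      e1 : Im (Lred ·v_) (λ i → from c (to c (dropApex x)) i - from c (to c (dropApex y)) i)
      e1 = im-resp LLr _ _ (lin-sub (from-linear c) _ _) (im-map LLr (from-linear c) (from-im c) _ e)
      imr : Im (Lred ·v_) (dropApex (x -v y))
      imr = im-resp LLr _ _ (λ i → rearrange (from c (to c (dropApex x)) i) _ (x (Fin.suc i)) (y (Fin.suc i)))
              (im-+ LLr _ _ (im-sub LLr _ _ e1 (from∘to c (dropApex x))) (from∘to c (dropApex y)))
        where rearrange : ∀ a b c d → a - b - (a - c) + (b - d) ≡ c - d
              rearrange = solve-∀
    surj : ∀ z → Σ (Vect (suc m)) λ x → Torsion L x × (to c (dropApex x) ≈[ K ] z)
    surj z = balance u , tor , to∘from c z
      where
      u = from c z
      tor : Torsion L (balance u)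
      tor with Lred-torsion u
      ... | k , k1 , e = k , k1 , im-lift _ s0 e
        where s0 : sumFin (suc m) (k *v balance u) ≡ + 0
              s0 = trans (sumFin-*ˡ (suc m) (+ k) (balance u)) (trans (cong (+ k *_) (balance-sum u)) (ℤP.*-zeroʳ (+ k)))

module Block (n : ℕ) where
  select : Vect n → Vect n → Fin n ⊎ Fin n → ℤ
  select a b (inj₁ c) = a c
  select a b (inj₂ c) = b c

  join : Vect n → Vect n → Vect (n ℕ.+ n)
  join a b i = select a b (splitAt n i)

  upper lower : Vect (n ℕ.+ n) → Vect n
  upper y c = y (c ↑ˡ n)
  lower y c = y (n ↑ʳ c)

  join-upper : ∀ a b c → join a b (c ↑ˡ n) ≡ a c
  join-upper a b c rewrite splitAt-↑ˡ n c n = refl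

  join-lower : ∀ a b c → join a b (n ↑ʳ c) ≡ b c
  join-lower a b c rewrite splitAt-↑ʳ n n c = refl

  join-split : ∀ y i → y i ≡ join (upper y) (lower y) i
  join-split y i with splitAt n i in eq
  ... | inj₁ a = cong y (sym (splitAt⁻¹-↑ˡ eq))
  ... | inj₂ a = cong y (sym (splitAt⁻¹-↑ʳ eq))

  join-cong : ∀ a b a' b' → a ≐ a' → b ≐ b' → join a b ≐ join a' b'
  join-cong a b a' b' ea eb i with splitAt n i
  ... | inj₁ c = ea c
  ... | inj₂ c = eb c

  join-sub : ∀ a b a' b' → (λ i → join a b i - join a' b' i) ≐ join (λ c → a c - a' c) (λ c → b c - b' c)
  join-sub a b a' b' i with splitAt n i
  ... | inj₁ c = refl
  ... | inj₂ c = refl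

  join-add : ∀ a b a' b' → join (λ c → a c + a' c) (λ c → b c + b' c) ≐ (λ i → join a b i + join a' b' i)
  join-add a b a' b' i with splitAt n i
  ... | inj₁ c = refl
  ... | inj₂ c = refl

  module _ (F₁ F₂ : Vect n → Vect n) (F₁-linear : IsLinear F₁) (F₂-linear : IsLinear F₂) where

    blockOp : Vect (n ℕ.+ n) → Vect (n ℕ.+ n)
    blockOp y = join (λ a → F₁ (upper y) a - lower y a) (λ a → F₂ (lower y) a - upper y a)

    schur : Vect n → Vect n
    schur w a = F₁ (F₂ w) a - w a

    blockOp-linear : IsLinear blockOp
    blockOp-linear = record
      { lin-cong = λ x y e → join-cong _ _ _ _
          (λ a → cong₂ _-_ (lin-cong F₁-linear _ _ (λ c → e (c ↑ˡ n)) a) (e (n ↑ʳ a)))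
          (λ a → cong₂ _-_ (lin-cong F₂-linear _ _ (λ c → e (n ↑ʳ c)) a) (e (a ↑ˡ n)))
      ; lin-+ = λ x y i → trans (join-cong _ _ _ _
          (λ a → trans (cong (_- (lower x a + lower y a)) (lin-+ F₁-linear (upper x) (upper y) a))
                       (interchange (F₁ (upper x) a) (F₁ (upper y) a) (lower x a) (lower y a)))
          (λ a → trans (cong (_- (upper x a + upper y a)) (lin-+ F₂-linear (lower x) (lower y) a))
                       (interchange (F₂ (lower x) a) (F₂ (lower y) a) (upper x a) (upper y a))) i)
          (join-add _ _ _ _ i) }
      where
      interchange : ∀ a b c d → a + b - (c + d) ≡ (a - c) + (b - d)
      interchange = solve-∀

    schur-linear : IsLinear schur
    schur-linear = record
      { lin-cong = λ x y e a → cong₂ _-_ (lin-cong F₁-linear _ _ (lin-cong F₂-linear _ _ e) a) (e a)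
      ; lin-+ = λ x y a →
          trans (cong (_- (x a + y a)) (trans (lin-cong F₁-linear _ _ (lin-+ F₂-linear x y) a) (lin-+ F₁-linear (F₂ x) (F₂ y) a)))
                (interchange (F₁ (F₂ x) a) (F₁ (F₂ y) a) (x a) (y a)) }
      where
      interchange : ∀ a b c d → a + b - (c + d) ≡ (a - c) + (b - d)
      interchange = solve-∀

    -- Eliminating the lower block: (u , v) ↦ u + F₁ v, with inverse w ↦ (w , 0).
    cokerIso-block-schur : CokerIso blockOp schur
    cokerIso-block-schur = record
      { to = collapse ; from = embed ; to-linear = collapse-linear ; from-linear = embed-linear
      ; to-im = λ y → lower y , λ a → sym (collapse-blockOp y a)
      ; from-im = λ w → join (F₂ w) w , blockOp-embed-schur w
      ; from∘to = λ y → join (lower y) (λ _ → + 0) , embed-collapse y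
      ; to∘from = λ w → (λ _ → + 0) , λ a → trans (lin-0 schur-linear a) (sym (collapse-embed w a)) }
      where
      collapse : Vect (n ℕ.+ n) → Vect n
      collapse y a = upper y a + F₁ (lower y) a
      embed : Vect n → Vect (n ℕ.+ n)
      embed w = join w (λ _ → + 0)
      collapse-linear : IsLinear collapse
      collapse-linear = record
        { lin-cong = λ x y e a → cong₂ _+_ (e (a ↑ˡ n)) (lin-cong F₁-linear _ _ (λ c → e (n ↑ʳ c)) a)
        ; lin-+ = λ x y a → trans (cong (_+_ (upper x a + upper y a)) (lin-+ F₁-linear (lower x) (lower y) a))
                                   (interchange (upper x a) (upper y a) (F₁ (lower x) a) (F₁ (lower y) a)) }
        where interchange : ∀ a b c d → a + b + (c + d) ≡ (a + c) + (b + d)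
              interchange = solve-∀
      embed-linear : IsLinear embed
      embed-linear = record
        { lin-cong = λ x y e → join-cong _ _ _ _ e (λ _ → refl)
        ; lin-+ = λ x y → join-add x (λ _ → + 0) y (λ _ → + 0) }
      collapse-blockOp : ∀ y a → collapse (blockOp y) a ≡ schur (lower y) a
      collapse-blockOp y a =
        trans (cong₂ _+_ (join-upper _ _ a) (lin-cong F₁-linear _ _ (join-lower _ _) a))
          (trans (cong (_+_ (F₁ u a - v a)) (lin-sub F₁-linear (F₂ v) u a)) (cancel (F₁ u a) (v a) (F₁ (F₂ v) a)))
        where u = upper y
              v = lower y
              cancel : ∀ a b c → a - b + (c - a) ≡ c - b
              cancel = solve-∀
      blockOp-embed-schur : ∀ w → blockOp (join (F₂ w) w) ≐ embed (schur w)
      blockOp-embed-schur w = join-cong _ _ _ _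
        (λ a → cong₂ _-_ (lin-cong F₁-linear _ _ (join-upper _ _) a) (join-lower _ _ a))
        (λ a → trans (cong₂ _-_ (lin-cong F₂-linear _ _ (join-lower _ _) a) (join-upper _ _ a)) (ℤP.+-inverseʳ (F₂ w a)))
      embed-collapse : ∀ y → blockOp (join (lower y) (λ _ → + 0)) ≐ (λ i → embed (collapse y) i - y i)
      embed-collapse y i = trans (join-cong _ _ _ _
          (λ a → trans (cong₂ _-_ (lin-cong F₁-linear _ _ (join-upper _ _) a) (join-lower _ _ a))
                       (cancel (F₁ (lower y) a) (upper y a)))
          (λ a → cong₂ _-_ (trans (lin-cong F₂-linear _ _ (join-lower _ _) a) (lin-0 F₂-linear a)) (join-upper _ _ a)) i)
        (sym (trans (cong (_-_ (embed (collapse y) i)) (join-split y i)) (join-sub _ _ _ _ i)))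
        where cancel : ∀ a b → a - + 0 ≡ b + a - b
              cancel = solve-∀
      collapse-embed : ∀ w a → collapse (embed w) a - w a ≡ + 0
      collapse-embed w a =
        trans (cong (_- w a) (cong₂ _+_ (join-upper _ _ a) (trans (lin-cong F₁-linear _ _ (join-lower _ _) a) (lin-0 F₁-linear a))))
              (cancel (w a))
        where cancel : ∀ a → a + + 0 - a ≡ + 0
              cancel = solve-∀

module ModularTranslation (n : ℕ) .{{_ : NonZero n}} where

  [m%n+k]%n≡[m+k]%n : ∀ m k → (m % n ℕ.+ k) % n ≡ (m ℕ.+ k) % n
  [m%n+k]%n≡[m+k]%n m k = sym (trans (%-distribˡ-+ m k n)
    (trans (cong (λ v → (v ℕ.+ k % n) % n) (sym (m%n%n≡m%n m n))) (sym (%-distribˡ-+ (m % n) k n))))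

  translation-fixed⇒0 : ∀ c d → d < n → (c ℕ.+ d) % n ≡ c % n → d ≡ 0
  translation-fixed⇒0 c d d<n e = core (c % n) (m%n<n c n) (trans ([m%n+k]%n≡[m+k]%n c d) e)
    where
    core : ∀ r → r < n → (r ℕ.+ d) % n ≡ r → d ≡ 0
    core r r<n e' with r ℕ.+ d ℕ.<? n
    ... | yes lt = ℕP.+-cancelˡ-≡ r d 0 (trans (trans (sym (m<n⇒m%n≡m lt)) e') (sym (ℕP.+-identityʳ r)))
    ... | no ge = ⊥-elim (ℕP.<-irrefl (ℕP.+-cancelˡ-≡ r d n r+d≡r+n) d<n)
      where
      n≤r+d : n ≤ r ℕ.+ d
      n≤r+d = ℕP.≮⇒≥ ge
      r+d∸n<n : r ℕ.+ d ∸ n < n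
      r+d∸n<n = ℕP.+-cancelʳ-< n (r ℕ.+ d ∸ n) n
        (subst (_< n ℕ.+ n) (sym (ℕP.m∸n+n≡m n≤r+d)) (ℕP.+-mono-< r<n d<n))
      r+d∸n≡r : r ℕ.+ d ∸ n ≡ r
      r+d∸n≡r = trans (sym (m<n⇒m%n≡m r+d∸n<n)) (trans (m≤n⇒[n∸m]%m≡n%m n≤r+d) e')
      r+d≡r+n : r ℕ.+ d ≡ r ℕ.+ n
      r+d≡r+n = trans (sym (ℕP.m∸n+n≡m n≤r+d)) (cong (ℕ._+ n) r+d∸n≡r)

  translation-gap-zero : ∀ a u v → u ≤ v → v < n → (a ℕ.+ v) % n ≡ (a ℕ.+ u) % n → v ∸ u ≡ 0
  translation-gap-zero a u v u≤v v<n e = translation-fixed⇒0 (a ℕ.+ u) (v ∸ u) (ℕP.≤-<-trans (ℕP.m∸n≤m v u) v<n)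
    (trans (cong (_% n) (trans (ℕP.+-assoc a u (v ∸ u)) (cong (a ℕ.+_) (ℕP.m+[n∸m]≡n u≤v)))) e)

  translation-injective : ∀ a x y → x < n → y < n → (a ℕ.+ x) % n ≡ (a ℕ.+ y) % n → x ≡ y
  translation-injective a x y x<n y<n e with ℕP.≤-total x y
  ... | inj₁ x≤y = sym (trans (sym (ℕP.m∸n+n≡m x≤y)) (cong (ℕ._+ x) (translation-gap-zero a x y x≤y y<n (sym e))))
  ... | inj₂ y≤x = trans (sym (ℕP.m∸n+n≡m y≤x)) (cong (ℕ._+ y) (translation-gap-zero a y x y≤x x<n e))

module Circulant (n' : ℕ) {k : ℕ} (st : Fin k → ℕ) (V : ValidSteps (suc n') st) where
  n : ℕ
  n = suc n'

  open ModularTranslation n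

  step-pos : ∀ r → 1 ℕ.≤ st r
  step-pos r = proj₁ V r
  2step<n : ∀ r → 2 ℕ.* st r ℕ.< n
  2step<n r = proj₁ (proj₂ V) r
  step-mono : ∀ r t → r Fin.< t → st r ℕ.< st t
  step-mono = proj₂ (proj₂ V)

  step+step<n : ∀ r → st r ℕ.+ st r ℕ.< n
  step+step<n r = subst (ℕ._< n) (cong (st r ℕ.+_) (ℕP.+-identityʳ (st r))) (2step<n r)

  step<n : ∀ r → st r ℕ.< n
  step<n r = ℕP.≤-<-trans (ℕP.m≤m+n (st r) (st r)) (step+step<n r)

  step≢0 : ∀ r → st r ≢ 0
  step≢0 r e = ℕP.<⇒≢ (step-pos r) (sym e)

  two-steps<n : ∀ r r' → st r ℕ.+ st r' ℕ.< n
  two-steps<n r r' with ℕP.≤-total (st r) (st r')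
  ... | inj₁ r≤r' = ℕP.≤-<-trans (ℕP.+-monoˡ-≤ (st r') r≤r') (step+step<n r')
  ... | inj₂ r'≤r = ℕP.≤-<-trans (ℕP.+-monoʳ-≤ (st r) r'≤r) (step+step<n r)

  step-injective : ∀ r r' → st r ≡ st r' → r ≡ r'
  step-injective r r' e with FinP.<-cmp r r'
  ... | tri< lt _ _ = ⊥-elim (ℕP.<-irrefl e (step-mono r r' lt))
  ... | tri≈ _ eq _ = eq
  ... | tri> _ _ gt = ⊥-elim (ℕP.<-irrefl (sym e) (step-mono r' r gt))

  IsFwd IsBwd : Fin k → Fin n → Fin n → Bool
  IsFwd r a b = does (toℕ b ℕ.≟ (toℕ a ℕ.+ st r) % n)
  IsBwd r a b = does (toℕ a ℕ.≟ (toℕ b ℕ.+ st r) % n)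

  fwd bwd : Fin n → Fin k → Fin n
  fwd a r = fromℕ< (m%n<n (toℕ a ℕ.+ st r) n)
  bwd a r = fromℕ< (m%n<n (toℕ a ℕ.+ (n ∸ st r)) n)

  isFwd-unique : ∀ r a b → IsFwd r a b ≡ true → b ≡ fwd a r
  isFwd-unique r a b e = toℕ-injective (trans (≟-true⇒≡ (toℕ b) ((toℕ a ℕ.+ st r) % n) e) (sym (toℕ-fromℕ< _)))

  isFwd-fwd : ∀ r a → IsFwd r a (fwd a r) ≡ true
  isFwd-fwd r a = ≡⇒≟-true (toℕ (fwd a r)) ((toℕ a ℕ.+ st r) % n) (toℕ-fromℕ< _)

  isBwd-unique : ∀ r a b → IsBwd r a b ≡ true → b ≡ bwd a r
  isBwd-unique r a b e = toℕ-injective (trans h (sym (toℕ-fromℕ< _)))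
    where
    s = st r
    h : toℕ b ≡ (toℕ a ℕ.+ (n ∸ s)) % n
    h = sym (begin
        (toℕ a ℕ.+ (n ∸ s)) % n ≡⟨ cong (λ v → (v ℕ.+ (n ∸ s)) % n) (≟-true⇒≡ (toℕ a) ((toℕ b ℕ.+ s) % n) e) ⟩
        ((toℕ b ℕ.+ s) % n ℕ.+ (n ∸ s)) % n ≡⟨ [m%n+k]%n≡[m+k]%n (toℕ b ℕ.+ s) (n ∸ s) ⟩
        (toℕ b ℕ.+ s ℕ.+ (n ∸ s)) % n ≡⟨ cong (_% n) (trans (ℕP.+-assoc (toℕ b) s (n ∸ s)) (cong (toℕ b ℕ.+_) (ℕP.m+[n∸m]≡n (ℕP.<⇒≤ (step<n r))))) ⟩
        (toℕ b ℕ.+ n) % n ≡⟨ [m+n]%n≡m%n (toℕ b) n ⟩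
        toℕ b % n ≡⟨ m<n⇒m%n≡m (toℕ<n b) ⟩
        toℕ b ∎)
      where open ≡-Reasoning

  isBwd-bwd : ∀ r a → IsBwd r a (bwd a r) ≡ true
  isBwd-bwd r a = ≡⇒≟-true (toℕ a) ((toℕ (bwd a r) ℕ.+ st r) % n) (sym (begin
        (toℕ (bwd a r) ℕ.+ s) % n ≡⟨ cong (λ v → (v ℕ.+ s) % n) (toℕ-fromℕ< (m%n<n (toℕ a ℕ.+ (n ∸ s)) n)) ⟩
        ((toℕ a ℕ.+ (n ∸ s)) % n ℕ.+ s) % n ≡⟨ [m%n+k]%n≡[m+k]%n (toℕ a ℕ.+ (n ∸ s)) s ⟩
        (toℕ a ℕ.+ (n ∸ s) ℕ.+ s) % n ≡⟨ cong (_% n) (trans (ℕP.+-assoc (toℕ a) (n ∸ s) s) (cong (toℕ a ℕ.+_) (ℕP.m∸n+n≡m (ℕP.<⇒≤ (step<n r))))) ⟩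
        (toℕ a ℕ.+ n) % n ≡⟨ [m+n]%n≡m%n (toℕ a) n ⟩
        toℕ a % n ≡⟨ m<n⇒m%n≡m (toℕ<n a) ⟩
        toℕ a ∎))
    where open ≡-Reasoning
          s = st r

  isFwd-step-unique : ∀ a b r r' → IsFwd r a b ≡ true → IsFwd r' a b ≡ true → r ≡ r'
  isFwd-step-unique a b r r' e e' = step-injective r r' (translation-injective (toℕ a) (st r) (st r') (step<n r) (step<n r')
    (trans (sym (≟-true⇒≡ (toℕ b) _ e)) (≟-true⇒≡ (toℕ b) _ e')))

  isBwd-step-unique : ∀ a b r r' → IsBwd r a b ≡ true → IsBwd r' a b ≡ true → r ≡ r'
  isBwd-step-unique a b r r' e e' = step-injective r r' (translation-injective (toℕ b) (st r) (st r') (step<n r) (step<n r')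
    (trans (sym (≟-true⇒≡ (toℕ a) _ e)) (≟-true⇒≡ (toℕ a) _ e')))

  fwd-bwd-disjoint : ∀ a b r r' → IsFwd r a b ≡ true → IsBwd r' a b ≡ true → ⊥
  fwd-bwd-disjoint a b r r' e e' = step≢0 r (ℕP.m+n≡0⇒m≡0 (st r) (translation-fixed⇒0 (toℕ a) (st r ℕ.+ st r') (two-steps<n r r') h))
    where
    open ≡-Reasoning
    h : (toℕ a ℕ.+ (st r ℕ.+ st r')) % n ≡ toℕ a % n
    h = begin
      (toℕ a ℕ.+ (st r ℕ.+ st r')) % n ≡⟨ cong (_% n) (sym (ℕP.+-assoc (toℕ a) (st r) (st r'))) ⟩
      (toℕ a ℕ.+ st r ℕ.+ st r') % n ≡⟨ sym ([m%n+k]%n≡[m+k]%n (toℕ a ℕ.+ st r) (st r')) ⟩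
      ((toℕ a ℕ.+ st r) % n ℕ.+ st r') % n ≡⟨ cong (λ v → (v ℕ.+ st r') % n) (sym (≟-true⇒≡ (toℕ b) ((toℕ a ℕ.+ st r) % n) e)) ⟩
      (toℕ b ℕ.+ st r') % n ≡⟨ sym (≟-true⇒≡ (toℕ a) ((toℕ b ℕ.+ st r') % n) e') ⟩
      toℕ a ≡⟨ sym (m<n⇒m%n≡m (toℕ<n a)) ⟩
      toℕ a % n ∎

  circSum : Vect n → Vect n
  circSum u a = sumFin n (λ b → bool→ℤ (circAdj n st a b) * u b)

  circSum-≡ : ∀ u a → circSum u a ≡ sumFin k (λ r → u (fwd a r) + u (bwd a r))
  circSum-≡ u a = begin
      sumFin n (λ b → bool→ℤ (anyFin k (λ r → IsFwd r a b ∨ IsBwd r a b)) * u b)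
    ≡⟨ sumFin-cong n (λ b → trans (cong (_* u b) (anyFin-disjoint k (λ r → IsFwd r a b) (λ r → IsBwd r a b) (isFwd-step-unique a b) (isBwd-step-unique a b) (fwd-bwd-disjoint a b)))
          (trans (ℤP.*-comm _ (u b)) (sym (sumFin-*ˡ k (u b) (λ r → bool→ℤ (IsFwd r a b) + bool→ℤ (IsBwd r a b)))))) ⟩
      sumFin n (λ b → sumFin k (λ r → u b * (bool→ℤ (IsFwd r a b) + bool→ℤ (IsBwd r a b))))
    ≡⟨ sumFin-swap n k (λ b r → u b * (bool→ℤ (IsFwd r a b) + bool→ℤ (IsBwd r a b))) ⟩
      sumFin k (λ r → sumFin n (λ b → u b * (bool→ℤ (IsFwd r a b) + bool→ℤ (IsBwd r a b))))
    ≡⟨ sumFin-cong k (λ r → trans (sumFin-cong n (λ b → rearrange (u b) (bool→ℤ (IsFwd r a b)) (bool→ℤ (IsBwd r a b))))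
         (trans (sumFin-add n (λ b → bool→ℤ (IsFwd r a b) * u b) (λ b → bool→ℤ (IsBwd r a b) * u b)) (cong₂ _+_
           (sumFin-unique-support n (IsFwd r a) u (fwd a r) (isFwd-unique r a) (isFwd-fwd r a))
           (sumFin-unique-support n (IsBwd r a) u (bwd a r) (isBwd-unique r a) (isBwd-bwd r a))))) ⟩
      sumFin k (λ r → u (fwd a r) + u (bwd a r))
    ∎
    where open ≡-Reasoning
          rearrange : ∀ u x y → u * (x + y) ≡ x * u + y * u
          rearrange = solve-∀

  circAdj-sym : ∀ a b → circAdj n st a b ≡ circAdj n st b a
  circAdj-sym a b = anyFin-cong k _ _ (λ r → ∨-comm (IsFwd r a b) (IsBwd r a b))

  no-self-step : ∀ a r → ¬ (IsFwd r a a ≡ true)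
  no-self-step a r e = step≢0 r (translation-fixed⇒0 (toℕ a) (st r) (step<n r)
    (trans (sym (≟-true⇒≡ (toℕ a) ((toℕ a ℕ.+ st r) % n) e)) (sym (m<n⇒m%n≡m (toℕ<n a)))))

  circAdj-irrefl : ∀ a → circAdj n st a a ≡ false
  circAdj-irrefl a = bool→ℤ≡0⇒false (trans
    (anyFin-disjoint k (λ r → IsFwd r a a) (λ r → IsBwd r a a) (isFwd-step-unique a a) (isBwd-step-unique a a) (fwd-bwd-disjoint a a))
    (sumFin-silent k _ _ (no-self-step a) (no-self-step a)))

module ConeOverCobordism (n' : ℕ) {k l : ℕ} (s₁ : Fin k → ℕ) (s₂ : Fin l → ℕ)
  (V₁ : ValidSteps (suc n') s₁) (V₂ : ValidSteps (suc n') s₂) where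
  n : ℕ
  n = suc n'

  module C₁ = Circulant n' s₁ V₁
  module C₂ = Circulant n' s₂ V₂

  A : Fin (suc (n ℕ.+ n)) → Fin (suc (n ℕ.+ n)) → Bool
  A = coneCobAdj n s₁ s₂

  coneAdjV-sym : ∀ u v → coneAdjV n s₁ s₂ u v ≡ coneAdjV n s₁ s₂ v u
  coneAdjV-sym (inj₁ _) (inj₁ _) = refl
  coneAdjV-sym (inj₁ _) (inj₂ _) = refl
  coneAdjV-sym (inj₂ _) (inj₁ _) = refl
  coneAdjV-sym (inj₂ (inj₁ a)) (inj₂ (inj₁ b)) = C₁.circAdj-sym a b
  coneAdjV-sym (inj₂ (inj₂ a)) (inj₂ (inj₂ b)) = C₂.circAdj-sym a b
  coneAdjV-sym (inj₂ (inj₁ a)) (inj₂ (inj₂ b)) = does-≟-sym a b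
  coneAdjV-sym (inj₂ (inj₂ a)) (inj₂ (inj₁ b)) = does-≟-sym a b

  A-sym : ∀ i j → A i j ≡ A j i
  A-sym i j = coneAdjV-sym (coneView n i) (coneView n j)

  apex-adjacent : ∀ i → A (Fin.suc i) Fin.zero ≡ true
  apex-adjacent i = refl

  coneAdjV-irrefl : ∀ v → coneAdjV n s₁ s₂ v v ≡ false
  coneAdjV-irrefl (inj₁ _) = refl
  coneAdjV-irrefl (inj₂ (inj₁ a)) = C₁.circAdj-irrefl a
  coneAdjV-irrefl (inj₂ (inj₂ a)) = C₂.circAdj-irrefl a

  open ConeReduction A A-sym apex-adjacent (λ i → coneAdjV-irrefl (coneView n i)) public
  open Block n public

  M₁ M₂ : Mat n n
  M₁ a b = bool→ℤ (circAdj n s₁ a b)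
  M₂ a b = bool→ℤ (circAdj n s₂ a b)

  D₁ D₂ : ℤ
  D₁ = + (2 ℕ.* k ℕ.+ 2)
  D₂ = + (2 ℕ.* l ℕ.+ 2)

  F₁ F₂ : Vect n → Vect n
  F₁ u a = D₁ * u a - (M₁ ·v u) a
  F₂ u a = D₂ * u a - (M₂ ·v u) a

  F₁-linear : IsLinear F₁
  F₁-linear = diagMinus-linear D₁ M₁
  F₂-linear : IsLinear F₂
  F₂-linear = diagMinus-linear D₂ M₂

  neighbourSum : ∀ (v : Fin n ⊎ Fin n) (y : Vect (n ℕ.+ n)) →
    sumFin (n ℕ.+ n) (λ j → bool→ℤ (coneAdjV n s₁ s₂ (inj₂ v) (inj₂ (splitAt n j))) * y j)
    ≡ select (λ a → (M₁ ·v upper y) a + lower y a) (λ a → (M₂ ·v lower y) a + upper y a) v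
  neighbourSum v y = trans (sumFin-splitAt n n (λ j → bool→ℤ (coneAdjV n s₁ s₂ (inj₂ v) (inj₂ (splitAt n j))) * y j)) (trans (cong₂ _+_
      (sumFin-cong n (λ c → cong (λ z → bool→ℤ (coneAdjV n s₁ s₂ (inj₂ v) (inj₂ z)) * y (c ↑ˡ n)) (splitAt-↑ˡ n c n)))
      (sumFin-cong n (λ c → cong (λ z → bool→ℤ (coneAdjV n s₁ s₂ (inj₂ v) (inj₂ z)) * y (n ↑ʳ c)) (splitAt-↑ʳ n n c))))
      (fin v))
    where
    fin : ∀ v → sumFin n (λ c → bool→ℤ (coneAdjV n s₁ s₂ (inj₂ v) (inj₂ (inj₁ c))) * y (c ↑ˡ n))
              + sumFin n (λ c → bool→ℤ (coneAdjV n s₁ s₂ (inj₂ v) (inj₂ (inj₂ c))) * y (n ↑ʳ c))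
              ≡ select (λ a → (M₁ ·v upper y) a + lower y a) (λ a → (M₂ ·v lower y) a + upper y a) v
    fin (inj₁ a) = cong (_+_ ((M₁ ·v upper y) a)) (sumFin-δ a (lower y))
    fin (inj₂ a) = trans (cong (_+ (M₂ ·v lower y) a) (sumFin-δ a (upper y))) (ℤP.+-comm (upper y a) _)

  sumFin-two : ∀ m → sumFin m (λ _ → + 1 + + 1) ≡ + (2 ℕ.* m)
  sumFin-two zero = refl
  sumFin-two (suc m) = trans (cong (_+_ (+ 2)) (sumFin-two m)) (cong +_ (sym (ℕP.*-distribˡ-+ 2 1 m)))

  nat3 : ∀ m → 1 ℕ.+ (m ℕ.+ 1) ≡ m ℕ.+ 2
  nat3 m = trans (ℕP.+-comm 1 (m ℕ.+ 1)) (ℕP.+-assoc m 1 1)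

  deg-suc : ∀ i → deg (Fin.suc i) ≡ select (λ _ → D₁) (λ _ → D₂) (splitAt n i)
  deg-suc i = trans (cong (_+_ (+ 1)) (trans
      (sumFin-cong (n ℕ.+ n) (λ j → sym (ℤP.*-identityʳ (bool→ℤ (A (Fin.suc i) (Fin.suc j))))))
      (neighbourSum (splitAt n i) ones)))
    (h (splitAt n i))
    where
    h : ∀ v → + 1 + select (λ a → (M₁ ·v ones) a + ones {n} a) (λ a → (M₂ ·v ones) a + ones {n} a) v ≡ select (λ _ → D₁) (λ _ → D₂) v
    h (inj₁ a) = trans (cong (λ z → + 1 + (z + + 1)) (trans (C₁.circSum-≡ ones a) (sumFin-two k))) (cong +_ (nat3 (2 ℕ.* k)))
    h (inj₂ a) = trans (cong (λ z → + 1 + (z + + 1)) (trans (C₂.circSum-≡ ones a) (sumFin-two l))) (cong +_ (nat3 (2 ℕ.* l)))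

  Lred≡blockOp : ∀ y i → (Lred ·v y) i ≡ blockOp F₁ F₂ F₁-linear F₂-linear y i
  Lred≡blockOp y i = trans (sym (trans (laplacian-·v-suc w i) (ℤP.+-identityʳ _)))
    (trans (laplacian-·v w (Fin.suc i)) (trans (cong (_-_ (deg (Fin.suc i) * y i)) (trans (ℤP.+-identityˡ _) (neighbourSum (splitAt n i) y)))
      (trans (cong₂ (λ d z → d * z - select (λ a → (M₁ ·v upper y) a + lower y a) (λ a → (M₂ ·v lower y) a + upper y a) (splitAt n i))
                    (deg-suc i) (join-split y i)) (fin (splitAt n i)))))
    where
    w : Vect (suc (n ℕ.+ n))
    w Fin.zero = + 0
    w (Fin.suc j) = y j
    rearrange : ∀ d u a b → d * u - (a + b) ≡ d * u - a - b
    rearrange = solve-∀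
    fin : ∀ v → select (λ _ → D₁) (λ _ → D₂) v * select (upper y) (lower y) v - select (λ a → (M₁ ·v upper y) a + lower y a) (λ a → (M₂ ·v lower y) a + upper y a) v
              ≡ select (λ a → F₁ (upper y) a - lower y a) (λ a → F₂ (lower y) a - upper y a) v
    fin (inj₁ a) = rearrange D₁ (upper y a) _ _
    fin (inj₂ a) = rearrange D₂ (lower y a) _ _

  cokerIso-Lred-schur : CokerIso (Lred ·v_) (schur F₁ F₂ F₁-linear F₂-linear)
  cokerIso-Lred-schur = cokerIso-trans (·v-linear Lred) (schur-linear F₁ F₂ F₁-linear F₂-linear)
    (cokerIso-resp Lred≡blockOp (cokerIso-refl (·v-linear Lred))) (cokerIso-block-schur F₁ F₂ F₁-linear F₂-linear)

sumRange≡sumFin : ∀ lo c f → sumRange lo c f ≡ sumFin c (λ j → f (lo + + toℕ j))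
sumRange≡sumFin lo zero f = refl
sumRange≡sumFin lo (suc c) f = cong₂ _+_ (cong f (sym (ℤP.+-identityʳ lo)))
  (trans (sumRange≡sumFin (lo + + 1) c f) (sumFin-cong c (λ j → cong f (ℤP.+-assoc lo (+ 1) (+ toℕ j)))))

range-lower : ∀ lo c (j : Fin c) → Le lo (lo + + toℕ j)
range-lower lo c j = le (toℕ j) refl

range-upper : ∀ lo c (j : Fin c) → Le (lo + + toℕ j + + 1) (lo + + c)
range-upper lo c j = le (c ℕ.∸ suc (toℕ j)) e
  where
  d = c ℕ.∸ suc (toℕ j)
  e0 : + c ≡ + 1 + + toℕ j + + d
  e0 = cong +_ (sym (ℕP.m+[n∸m]≡n (toℕ<n j)))
  rearrange : ∀ lo a b → lo + (+ 1 + a + b) ≡ lo + a + + 1 + b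
  rearrange = solve-∀
  e : lo + + c ≡ lo + + toℕ j + + 1 + + d
  e = trans (cong (_+_ lo) e0) (rearrange lo (+ toℕ j) (+ d))

sumRange-cong-on : ∀ lo c f g → (∀ e → Le lo e → Le (e + + 1) (lo + + c) → f e ≡ g e) → sumRange lo c f ≡ sumRange lo c g
sumRange-cong-on lo c f g h = trans (sumRange≡sumFin lo c f) (trans (sumFin-cong c (λ j → h _ (range-lower lo c j) (range-upper lo c j))) (sym (sumRange≡sumFin lo c g)))

sumRange-cong : ∀ lo c f g → (∀ e → f e ≡ g e) → sumRange lo c f ≡ sumRange lo c g
sumRange-cong lo c f g h = sumRange-cong-on lo c f g (λ e _ _ → h e)

sumRange-zero-on : ∀ lo c f → (∀ e → Le lo e → Le (e + + 1) (lo + + c) → f e ≡ + 0) → sumRange lo c f ≡ + 0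
sumRange-zero-on lo c f h = trans (sumRange-cong-on lo c f (λ _ → + 0) h) (trans (sumRange≡sumFin lo c (λ _ → + 0)) (sumFin-zero c (λ _ → refl)))

sumRange-split : ∀ lo a b f → sumRange lo (a ℕ.+ b) f ≡ sumRange lo a f + sumRange (lo + + a) b f
sumRange-split lo zero b f = trans (cong (λ z → sumRange z b f) (sym (ℤP.+-identityʳ lo))) (sym (ℤP.+-identityˡ _))
sumRange-split lo (suc a) b f = trans (cong (_+_ (f lo)) (trans (sumRange-split (lo + + 1) a b f)
    (cong (λ z → sumRange (lo + + 1) a f + sumRange z b f) (ℤP.+-assoc lo (+ 1) (+ a)))))
  (sym (ℤP.+-assoc (f lo) _ _))

sumRange-shift : ∀ lo c (g : ℤ → ℤ) i → sumRange lo c (λ e → g (e - i)) ≡ sumRange (lo - i) c g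
sumRange-shift lo c g i = trans (sumRange≡sumFin lo c _) (trans (sumFin-cong c (λ j → cong g (rearrange lo i (+ toℕ j)))) (sym (sumRange≡sumFin (lo - i) c g)))
  where rearrange : ∀ lo i a → lo + a - i ≡ lo - i + a
        rearrange = solve-∀

VanishesOutside : ℤ → ℕ → (ℤ → ℤ) → Set
VanishesOutside lo c f = ∀ e → Le (e + + 1) lo ⊎ Le (lo + + c) e → f e ≡ + 0

sumRange-nested : ∀ c lo lo1 c1 f → Le lo lo1 → Le (lo1 + + c1) (lo + + c) → VanishesOutside lo1 c1 f →
       sumRange lo c f ≡ sumRange lo1 c1 f
sumRange-nested c lo lo1 c1 f (le d1 p1) (le d2 p2) out =
  trans (cong (λ z → sumRange lo z f) ceq)
  (trans (sumRange-split lo d1 (c1 ℕ.+ d2) f)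
  (trans (cong₂ _+_ z1 (trans (cong (λ z → sumRange z (c1 ℕ.+ d2) f) (sym p1)) (sumRange-split lo1 c1 d2 f)))
  (trans (ℤP.+-identityˡ _) (trans (cong (_+_ (sumRange lo1 c1 f)) z2) (ℤP.+-identityʳ _)))))
  where
  zc : + c ≡ + d1 + (+ c1 + + d2)
  zc = trans (rearrange lo (+ c)) (trans (cong (λ z → z - lo) (trans p2 (cong (λ z → z + + c1 + + d2) p1))) (rearrange′ lo (+ d1) (+ c1) (+ d2)))
    where rearrange : ∀ lo c → c ≡ lo + c - lo
          rearrange = solve-∀
          rearrange′ : ∀ lo a b d → lo + a + b + d - lo ≡ a + (b + d)
          rearrange′ = solve-∀
  ceq : c ≡ d1 ℕ.+ (c1 ℕ.+ d2)
  ceq = ℤP.+-injective zc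
  z1 : sumRange lo d1 f ≡ + 0
  z1 = sumRange-zero-on lo d1 f (λ e _ (le d q) → out e (inj₁ (le d (trans p1 q))))
  z2 : sumRange (lo1 + + c1) d2 f ≡ + 0
  z2 = sumRange-zero-on (lo1 + + c1) d2 f (λ e le _ → out e (inj₂ le))

sumRange-support-indep : ∀ lo1 c1 lo2 c2 f → VanishesOutside lo1 c1 f → VanishesOutside lo2 c2 f → sumRange lo1 c1 f ≡ sumRange lo2 c2 f
sumRange-support-indep lo1 c1 lo2 c2 f o1 o2 = go (lo-min) (hi-max)
  where
  Rc : ∀ lo c → Le lo (lo + + c)
  Rc lo c = le c refl
  weak : ∀ {i j} → Le (i + + 1) j → Le i j
  weak {i} (le d p) = le (suc d) (trans p (ℤP.+-assoc i (+ 1) (+ d)))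
  lo-min : Σ ℤ λ lo → Le lo lo1 × Le lo lo2
  lo-min with Le-dichotomy lo1 lo2
  ... | inj₁ lt = lo1 , Le-refl lo1 , weak lt
  ... | inj₂ q = lo2 , q , Le-refl lo2
  hi-max : Σ ℤ λ hi → Le (lo1 + + c1) hi × Le (lo2 + + c2) hi
  hi-max with Le-dichotomy (lo1 + + c1) (lo2 + + c2)
  ... | inj₁ lt = _ , weak lt , Le-refl _
  ... | inj₂ q = _ , Le-refl _ , q
  go : (Σ ℤ λ lo → Le lo lo1 × Le lo lo2) → (Σ ℤ λ hi → Le (lo1 + + c1) hi × Le (lo2 + + c2) hi) →
       sumRange lo1 c1 f ≡ sumRange lo2 c2 f
  go (lo , a1 , a2) (hi , b1 , b2) with Le-trans a1 (Le-trans (Rc lo1 c1) b1)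
  ... | le c hc = trans (sym (sumRange-nested c lo lo1 c1 f a1 (subst (Le _) hc b1) o1)) (sumRange-nested c lo lo2 c2 f a2 (subst (Le _) hc b2) o2)

sumRange-add : ∀ lo c f g → sumRange lo c (λ e → f e + g e) ≡ sumRange lo c f + sumRange lo c g
sumRange-add lo c f g = trans (sumRange≡sumFin lo c _) (trans (sumFin-add c _ _) (sym (cong₂ _+_ (sumRange≡sumFin lo c f) (sumRange≡sumFin lo c g))))

sumRange-neg : ∀ lo c f → sumRange lo c (λ e → - f e) ≡ - sumRange lo c f
sumRange-neg lo c f = trans (sumRange≡sumFin lo c _) (trans (sumFin-neg c _) (cong -_ (sym (sumRange≡sumFin lo c f))))

sumRange-*ˡ : ∀ lo c k f → sumRange lo c (λ e → k * f e) ≡ k * sumRange lo c f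
sumRange-*ˡ lo c k f = trans (sumRange≡sumFin lo c _) (trans (sumFin-*ˡ c k _) (cong (k *_) (sym (sumRange≡sumFin lo c f))))

sumRange-*ʳ : ∀ lo c k f → sumRange lo c (λ e → f e * k) ≡ sumRange lo c f * k
sumRange-*ʳ lo c k f = trans (sumRange-cong lo c _ _ (λ e → ℤP.*-comm (f e) k)) (trans (sumRange-*ˡ lo c k f) (ℤP.*-comm k _))

sumRange-swap : ∀ lo c lo' c' (f : ℤ → ℤ → ℤ) →
  sumRange lo c (λ e → sumRange lo' c' (λ i → f e i)) ≡ sumRange lo' c' (λ i → sumRange lo c (λ e → f e i))
sumRange-swap lo c lo' c' f =
  trans (sumRange≡sumFin lo c _) (trans (sumFin-cong c (λ j → sumRange≡sumFin lo' c' _))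
  (trans (sumFin-swap c c' _) (trans (sumFin-cong c' (λ j → sym (sumRange≡sumFin lo c _))) (sym (sumRange≡sumFin lo' c' _)))))

vanishes-widen : ∀ {lo c lo1 c1 f} → Le lo lo1 → Le (lo1 + + c1) (lo + + c) → VanishesOutside lo1 c1 f → VanishesOutside lo c f
vanishes-widen a b o e (inj₁ x) = o e (inj₁ (Le-trans x a))
vanishes-widen a b o e (inj₂ x) = o e (inj₂ (Le-trans b x))

vanishes-mulʳ : ∀ {lo c f} (g : ℤ → ℤ) → VanishesOutside lo c f → VanishesOutside lo c (λ e → f e * g e)
vanishes-mulʳ {f = f} g o e h = trans (cong (_* g e) (o e h)) refl

vanishes-add : ∀ {lo c f g} → VanishesOutside lo c f → VanishesOutside lo c g → VanishesOutside lo c (λ e → f e + g e)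
vanishes-add o o' e h = cong₂ _+_ (o e h) (o' e h)

vanishes-sub : ∀ {lo c f g} → VanishesOutside lo c f → VanishesOutside lo c g → VanishesOutside lo c (λ e → f e - g e)
vanishes-sub o o' e h = cong₂ _-_ (o e h) (o' e h)

window-lo : ℕ → ℤ
window-lo b = - + b
window-size : ℕ → ℕ
window-size b = suc (2 ℕ.* b)

window-hi : ∀ b → window-lo b + + window-size b ≡ + b + + 1
window-hi b = trans (cong (λ z → - + b + z) e1) (rearrange (+ b))
  where
  e1 : + window-size b ≡ + 1 + (+ b + + b)
  e1 = cong (λ z → + suc (b ℕ.+ z)) (ℕP.+-identityʳ b)
  rearrange : ∀ x → - x + (+ 1 + (x + x)) ≡ x + + 1
  rearrange = solve-∀

-- Nothing in LPoly forces the coefficients to vanish outside [- bound , bound]; this holds for every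
-- polynomial built from constLP, monoLP, _+LP_, _-LP_, _*LP_ and sumLP.
WellSupported : LPoly → Set
WellSupported P = VanishesOutside (window-lo (bound P)) (window-size (bound P)) (coeff P)

vanishes-window-mono : ∀ {b b' f} → b ℕ.≤ b' → VanishesOutside (window-lo b) (window-size b) f → VanishesOutside (window-lo b') (window-size b') f
vanishes-window-mono {b} {b'} bb o = vanishes-widen l1 l2 o
  where
  d = b' ℕ.∸ b
  eb : + b' ≡ + b + + d
  eb = cong +_ (sym (ℕP.m+[n∸m]≡n bb))
  l1 : Le (window-lo b') (window-lo b)
  l1 = le d (trans (rearrange (+ b) (+ d)) (cong (λ z → - z + + d) (sym eb)))
    where rearrange : ∀ x y → - x ≡ - (x + y) + y
          rearrange = solve-∀
  l2 : Le (window-lo b + + window-size b) (window-lo b' + + window-size b')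
  l2 = le d (trans (window-hi b') (trans (cong (_+ + 1) eb) (trans (rearrange′ (+ b) (+ d)) (cong (λ z → z + + d) (sym (window-hi b))))))
    where rearrange′ : ∀ x y → x + y + + 1 ≡ x + + 1 + y
          rearrange′ = solve-∀

vanishes-point : ∀ a (k : ℤ) → VanishesOutside a 1 (λ e → if does (e ℤ.≟ a) then k else + 0)
vanishes-point a k e h with e ℤ.≟ a
... | no _ = refl
vanishes-point a k e (inj₁ (le d p)) | yes refl = ⊥-elim (Le-irrefl-suc e d p)
vanishes-point a k e (inj₂ (le d p)) | yes refl = ⊥-elim (Le-irrefl-suc e d p)

supported-const : ∀ c → WellSupported (constLP c)
supported-const c = vanishes-point (+ 0) c

window-lo-∣∣ : ∀ a → Le (window-lo ℤ.∣ a ∣) a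
window-lo-∣∣ (+ m) = le (m ℕ.+ m) (rearrange (+ m))
  where rearrange : ∀ x → x ≡ - x + (x + x)
        rearrange = solve-∀
window-lo-∣∣ -[1+ m ] = Le-refl _

window-hi-∣∣ : ∀ a → Le (a + + 1) (window-lo ℤ.∣ a ∣ + + window-size ℤ.∣ a ∣)
window-hi-∣∣ (+ m) = subst (Le (+ m + + 1)) (sym (window-hi m)) (Le-refl _)
window-hi-∣∣ -[1+ m ] = subst (Le (-[1+ m ] + + 1)) (sym (window-hi (suc m))) (le (suc m ℕ.+ suc m) (rearrange (+ m)))
  where rearrange : ∀ x → + 1 + x + + 1 ≡ - (+ 1 + x) + + 1 + (+ 1 + x + (+ 1 + x))
        rearrange = solve-∀

supported-mono : ∀ a → WellSupported (monoLP a)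
supported-mono a = vanishes-widen (window-lo-∣∣ a) (window-hi-∣∣ a) (vanishes-point a (+ 1))

supported-add : ∀ P Q → WellSupported P → WellSupported Q → WellSupported (P +LP Q)
supported-add P Q sp sq = vanishes-add (vanishes-window-mono (ℕP.m≤m⊔n (bound P) (bound Q)) sp) (vanishes-window-mono (ℕP.m≤n⊔m (bound P) (bound Q)) sq)

supported-sub : ∀ P Q → WellSupported P → WellSupported Q → WellSupported (P -LP Q)
supported-sub P Q sp sq = vanishes-sub (vanishes-window-mono (ℕP.m≤m⊔n (bound P) (bound Q)) sp) (vanishes-window-mono (ℕP.m≤n⊔m (bound P) (bound Q)) sq)

supported-sum : ∀ k (f : Fin k → LPoly) → (∀ r → WellSupported (f r)) → WellSupported (sumLP k f)
supported-sum zero f h = supported-const (+ 0)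
supported-sum (suc k) f h = supported-add (f Fin.zero) _ (h Fin.zero) (supported-sum k (λ r → f (Fin.suc r)) (λ r → h (Fin.suc r)))

product-index-shift : ∀ e i x y d d2 → e ≡ x + y + + 1 + d → x + + 1 ≡ i + + 1 + d2 → e - i ≡ y + + 1 + (d + d2)
product-index-shift e i x y d d2 p q = trans (cong₂ _-_ p ieq) (rearrange″ x y d d2)
  where
  ieq : i ≡ x - d2
  ieq = trans (rearrange i d2) (trans (cong (λ z → z - + 1 - d2) (sym q)) (rearrange′ x d2))
    where rearrange : ∀ i d2 → i ≡ i + + 1 + d2 - + 1 - d2
          rearrange = solve-∀
          rearrange′ : ∀ x d2 → x + + 1 - + 1 - d2 ≡ x - d2
          rearrange′ = solve-∀
  rearrange″ : ∀ x y d d2 → x + y + + 1 + d - (x - d2) ≡ y + + 1 + (d + d2)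
  rearrange″ = solve-∀

supported-mul : ∀ P Q → WellSupported P → WellSupported Q → WellSupported (P *LP Q)
supported-mul P Q sp sq e (inj₁ (le d p)) =
  sumRange-zero-on (window-lo bP) (window-size bP) _ (λ i (le d' q) _ → trans (cong (coeff P i *_) (sq (e - i) (inj₁ (le (d ℕ.+ d') (eq i d' q))))) (ℤP.*-zeroʳ (coeff P i)))
  where
  bP = bound P
  bQ = bound Q
  r1 : ∀ x y → - y ≡ - (x + y) + x
  r1 = solve-∀
  r2 : ∀ e x a b → e + + 1 + a + x ≡ e - (- x + b) + + 1 + (a + b)
  r2 = solve-∀
  eq : ∀ i d' → i ≡ window-lo bP + + d' → window-lo bQ ≡ e - i + + 1 + + (d ℕ.+ d')
  eq i d' q = trans (r1 (+ bP) (+ bQ)) (trans (cong (_+ + bP) p) (trans (r2 e (+ bP) (+ d) (+ d'))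
                (cong (λ z → e - z + + 1 + (+ d + + d')) (sym q))))
supported-mul P Q sp sq e (inj₂ (le d p)) =
  sumRange-zero-on (window-lo bP) (window-size bP) _ (λ i _ (le d2 q) → trans (cong (coeff P i *_) (sq (e - i) (inj₂ (le (d ℕ.+ d2) (eq i d2 q))))) (ℤP.*-zeroʳ (coeff P i)))
  where
  bP = bound P
  bQ = bound Q
  eq : ∀ i d2 → window-lo bP + + window-size bP ≡ i + + 1 + + d2 → e - i ≡ window-lo bQ + + window-size bQ + + (d ℕ.+ d2)
  eq i d2 q = trans (product-index-shift e i (+ bP) (+ bQ) (+ d) (+ d2) (trans p (cong (_+ + d) (window-hi (bP ℕ.+ bQ)))) (trans (sym (window-hi bP)) q))
                (cong (_+ + (d ℕ.+ d2)) (sym (window-hi bQ)))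

-- P(z) acting on sequences with z the forward shift.
act : LPoly → (ℤ → ℤ) → ℤ → ℤ
act P w x = sumRange (window-lo (bound P)) (window-size (bound P)) (λ e → coeff P e * w (x + e))

act-on-range : ∀ P → WellSupported P → ∀ lo c → VanishesOutside lo c (coeff P) → ∀ w x →
  sumRange lo c (λ e → coeff P e * w (x + e)) ≡ act P w x
act-on-range P sp lo c o w x = sumRange-support-indep lo c (window-lo (bound P)) (window-size (bound P)) _ (vanishes-mulʳ (λ e → w (x + e)) o) (vanishes-mulʳ (λ e → w (x + e)) sp)

act-cong : ∀ P w w' → (∀ z → w z ≡ w' z) → ∀ x → act P w x ≡ act P w' x
act-cong P w w' h x = sumRange-cong (window-lo (bound P)) (window-size (bound P)) (λ e → coeff P e * w (x + e)) (λ e → coeff P e * w' (x + e)) (λ e → cong (coeff P e *_) (h (x + e)))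

act-const : ∀ c w x → act (constLP c) w x ≡ c * w x
act-const c w x = trans (ℤP.+-identityʳ _) (cong (c *_) (cong w (ℤP.+-identityʳ x)))

act-mono : ∀ a w x → act (monoLP a) w x ≡ w (x + a)
act-mono a w x = trans (sym (act-on-range (monoLP a) (supported-mono a) a 1 (vanishes-point a (+ 1)) w x))
  (trans (ℤP.+-identityʳ _) (trans (cong (λ b → (if b then + 1 else + 0) * w (x + a)) (dec-true (a ℤ.≟ a) refl)) (ℤP.*-identityˡ _)))

act-add : ∀ P Q → WellSupported P → WellSupported Q → ∀ w x → act (P +LP Q) w x ≡ act P w x + act Q w x
act-add P Q sp sq w x =
  trans (sumRange-cong lo c (λ e → (coeff P e + coeff Q e) * w (x + e)) (λ e → coeff P e * w (x + e) + coeff Q e * w (x + e)) (λ e → ℤP.*-distribʳ-+ (w (x + e)) (coeff P e) (coeff Q e)))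
  (trans (sumRange-add lo c (λ e → coeff P e * w (x + e)) (λ e → coeff Q e * w (x + e))) (cong₂ _+_ (act-on-range P sp lo c (vanishes-window-mono (ℕP.m≤m⊔n (bound P) (bound Q)) sp) w x)
                                     (act-on-range Q sq lo c (vanishes-window-mono (ℕP.m≤n⊔m (bound P) (bound Q)) sq) w x)))
  where lo = window-lo (bound P ⊔ bound Q)
        c = window-size (bound P ⊔ bound Q)

act-sub : ∀ P Q → WellSupported P → WellSupported Q → ∀ w x → act (P -LP Q) w x ≡ act P w x - act Q w x
act-sub P Q sp sq w x =
  trans (sumRange-cong lo c (λ e → (coeff P e - coeff Q e) * w (x + e)) (λ e → coeff P e * w (x + e) + - (coeff Q e * w (x + e))) (λ e → rearrange (coeff P e) (coeff Q e) (w (x + e))))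
  (trans (sumRange-add lo c (λ e → coeff P e * w (x + e)) (λ e → - (coeff Q e * w (x + e)))) (cong₂ _+_ (act-on-range P sp lo c (vanishes-window-mono (ℕP.m≤m⊔n (bound P) (bound Q)) sp) w x)
                                     (trans (sumRange-neg lo c (λ e → coeff Q e * w (x + e))) (cong -_ (act-on-range Q sq lo c (vanishes-window-mono (ℕP.m≤n⊔m (bound P) (bound Q)) sq) w x)))))
  where lo = window-lo (bound P ⊔ bound Q)
        c = window-size (bound P ⊔ bound Q)
        rearrange : ∀ a b u → (a - b) * u ≡ a * u + - (b * u)
        rearrange = solve-∀

act-sumLP : ∀ k (f : Fin k → LPoly) → (∀ r → WellSupported (f r)) → ∀ w x → act (sumLP k f) w x ≡ sumFin k (λ r → act (f r) w x)
act-sumLP zero f h w x = act-const (+ 0) w x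
act-sumLP (suc k) f h w x = trans (act-add (f Fin.zero) _ (h Fin.zero) (supported-sum k _ (λ r → h (Fin.suc r))) w x)
  (cong (_+_ (act (f Fin.zero) w x)) (act-sumLP k (λ r → f (Fin.suc r)) (λ r → h (Fin.suc r)) w x))

act-mul : ∀ P Q → WellSupported P → WellSupported Q → ∀ w x → act (P *LP Q) w x ≡ act P (act Q w) x
act-mul P Q sp sq w x =
  trans (sumRange-cong LPQ CPQ (λ e → sumRange LP CP (λ i → coeff P i * coeff Q (e - i)) * w (x + e)) (λ e → sumRange LP CP (λ i → coeff P i * (coeff Q (e - i) * w (x + e))))
          (λ e → trans (sym (sumRange-*ʳ LP CP (w (x + e)) (λ i → coeff P i * coeff Q (e - i))))
                 (sumRange-cong LP CP (λ i → coeff P i * coeff Q (e - i) * w (x + e)) (λ i → coeff P i * (coeff Q (e - i) * w (x + e))) (λ i → ℤP.*-assoc (coeff P i) _ _))))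
  (trans (sumRange-swap LPQ CPQ LP CP (λ e i → coeff P i * (coeff Q (e - i) * w (x + e))))
  (sumRange-cong-on LP CP (λ i → sumRange LPQ CPQ (λ e → coeff P i * (coeff Q (e - i) * w (x + e)))) (λ i → coeff P i * act Q w (x + i))
     (λ i a b → trans (sumRange-*ˡ LPQ CPQ (coeff P i) (λ e → coeff Q (e - i) * w (x + e))) (cong (coeff P i *_) (inner i a b)))))
  where
  bP = bound P
  bQ = bound Q
  LP = window-lo bP
  CP = window-size bP
  LPQ = window-lo (bP ℕ.+ bQ)
  CPQ = window-size (bP ℕ.+ bQ)
  inner : ∀ i → Le LP i → Le (i + + 1) (LP + + CP) → sumRange LPQ CPQ (λ e → coeff Q (e - i) * w (x + e)) ≡ act Q w (x + i)
  inner i (le d q) (le d2 q2) =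
    trans (sumRange-cong LPQ CPQ (λ e → coeff Q (e - i) * w (x + e)) (λ e → Qw (e - i)) (λ e → cong (λ z → coeff Q (e - i) * w z) (rearrange x e i)))
    (trans (sumRange-shift LPQ CPQ Qw i) (act-on-range Q sq (LPQ - i) CPQ (vanishes-widen A B sq) w (x + i)))
    where
    Qw : ℤ → ℤ
    Qw f = coeff Q f * w (x + i + f)
    rearrange : ∀ x e i → x + e ≡ x + i + (e - i)
    rearrange = solve-∀
    A : Le (LPQ - i) (window-lo bQ)
    A = le d (trans (rearrange′ (+ bP) (+ bQ) (+ d)) (cong (λ z → - (+ bP + + bQ) - z + + d) (sym q)))
      where rearrange′ : ∀ x y d → - y ≡ - (x + y) - (- x + d) + d
            rearrange′ = solve-∀
    B : Le (window-lo bQ + + window-size bQ) (LPQ - i + + CPQ)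
    B = le d2 (trans (rearrange″ LPQ (+ CPQ) i) (trans (product-index-shift _ i (+ bP) (+ bQ) (+ 0) (+ d2) (trans (window-hi (bP ℕ.+ bQ)) (sym (ℤP.+-identityʳ _))) (trans (sym (window-hi bP)) q2))
           (trans (cong (λ z → z + (+ 0 + + d2)) (sym (window-hi bQ))) (cong (_+_ (window-lo bQ + + window-size bQ)) (ℤP.+-identityˡ (+ d2))))))
      where rearrange″ : ∀ a b i → a - i + b ≡ a + b - i
            rearrange″ = solve-∀

symMono : ∀ {k} (st : Fin k → ℕ) → Fin k → LPoly
symMono st r = monoLP (+ st r) +LP monoLP (- (+ st r))

supported-symMono : ∀ {k} (st : Fin k → ℕ) r → WellSupported (symMono st r)
supported-symMono st r = supported-add (monoLP (+ st r)) (monoLP (- (+ st r))) (supported-mono (+ st r)) (supported-mono (- + st r))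

supported-factorLP : ∀ k (st : Fin k → ℕ) → WellSupported (factorLP k st)
supported-factorLP k st = supported-sub (constLP (+ (2 ℕ.* k ℕ.+ 2))) (sumLP k (symMono st)) (supported-const _) (supported-sum k (symMono st) (supported-symMono st))

act-factorLP : ∀ k (st : Fin k → ℕ) w x → act (factorLP k st) w x ≡ + (2 ℕ.* k ℕ.+ 2) * w x - sumFin k (λ r → w (x + + st r) + w (x - + st r))
act-factorLP k st w x = trans (act-sub (constLP (+ (2 ℕ.* k ℕ.+ 2))) (sumLP k (symMono st)) (supported-const _) (supported-sum k (symMono st) (supported-symMono st)) w x)
  (cong₂ _-_ (act-const (+ (2 ℕ.* k ℕ.+ 2)) w x) (trans (act-sumLP k (symMono st) (supported-symMono st) w x)
     (sumFin-cong k (λ r → trans (act-add (monoLP (+ st r)) (monoLP (- (+ st r))) (supported-mono (+ st r)) (supported-mono (- + st r)) w x)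
        (cong₂ _+_ (act-mono (+ st r) w x) (act-mono (- + st r) w x))))))

supported-thePoly : ∀ k l (s₁ : Fin k → ℕ) (s₂ : Fin l → ℕ) → WellSupported (thePoly k l s₁ s₂)
supported-thePoly k l s₁ s₂ = supported-sub (factorLP k s₁ *LP factorLP l s₂) (constLP (+ 1)) (supported-mul _ _ (supported-factorLP k s₁) (supported-factorLP l s₂)) (supported-const _)

act-thePoly : ∀ k l (s₁ : Fin k → ℕ) (s₂ : Fin l → ℕ) w x →
  act (thePoly k l s₁ s₂) w x ≡ act (factorLP k s₁) (act (factorLP l s₂) w) x - w x
act-thePoly k l s₁ s₂ w x = trans (act-sub (factorLP k s₁ *LP factorLP l s₂) (constLP (+ 1)) (supported-mul _ _ (supported-factorLP k s₁) (supported-factorLP l s₂)) (supported-const _) w x)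
  (cong₂ _-_ (act-mul _ _ (supported-factorLP k s₁) (supported-factorLP l s₂) w x) (trans (act-const (+ 1) w x) (ℤP.*-identityˡ (w x))))

+-∸ : ∀ a b → b ℕ.≤ a → + (a ∸ b) ≡ + a - + b
+-∸ a b ba = trans (rearrange (+ (a ∸ b)) (+ b)) (cong (λ z → + z - + b) (ℕP.m∸n+n≡m ba))
  where rearrange : ∀ x y → x ≡ x + y - y
        rearrange = solve-∀

module Periodic (n' : ℕ) where
  n : ℕ
  n = suc n'

  natRep : ℤ → ℕ
  natRep (+ m) = m
  natRep -[1+ m ] = n ℕ.* suc m ∸ suc m

  natRep-≡ : ∀ e → Σ ℤ λ t → + natRep e ≡ e + t * + n
  natRep-≡ (+ m) = + 0 , sym (ℤP.+-identityʳ (+ m))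
  natRep-≡ -[1+ m ] = + suc m , trans (+-∸ (n ℕ.* suc m) (suc m) (ℕP.m≤n*m (suc m) n))
    (trans (cong (_- + suc m) (ℤP.pos-* n (suc m))) (rearrange (+ n) (+ suc m)))
    where rearrange : ∀ x y → x * y - y ≡ - y + y * x
          rearrange = solve-∀

  ≡-mod⇒%≡ : ∀ a b (q : ℤ) → + a ≡ + b + q * + n → a % n ≡ b % n
  ≡-mod⇒%≡ a b (+ k) e = trans (cong (_% n) (ℤP.+-injective (trans e (cong (_+_ (+ b)) (sym (ℤP.pos-* k n)))))) ([m+kn]%n≡m%n b k n)
  ≡-mod⇒%≡ a b -[1+ k ] e = sym (trans (cong (_% n) (ℤP.+-injective (trans e2 (cong (_+_ (+ a)) (sym (ℤP.pos-* (suc k) n)))))) ([m+kn]%n≡m%n a (suc k) n))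
    where
    solve-for-b : ∀ a b q x → a ≡ b + (- q) * x → b ≡ a + q * x
    solve-for-b a b q x h = trans (rearrange b q x) (cong (λ z → z + q * x) (sym h))
      where rearrange : ∀ b q x → b ≡ b + (- q) * x + q * x
            rearrange = solve-∀
    e2 : + b ≡ + a + + suc k * + n
    e2 = solve-for-b (+ a) (+ b) (+ suc k) (+ n) e

  residue : ℤ → Fin n
  residue e = fromℕ< (m%n<n (natRep e) n)

  residue-periodic : ∀ e e' q → e ≡ e' + q * + n → residue e ≡ residue e'
  residue-periodic e e' q h with natRep-≡ e | natRep-≡ e'
  ... | t1 , p1 | t2 , p2 = toℕ-injective (trans (toℕ-fromℕ< _) (trans (≡-mod⇒%≡ (natRep e) (natRep e') (q + t1 - t2) eq) (sym (toℕ-fromℕ< _))))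
    where
    eq : + natRep e ≡ + natRep e' + (q + t1 - t2) * + n
    eq = trans p1 (trans (cong (λ z → z + t1 * + n) h) (trans (rearrange e' q t1 t2 (+ n)) (cong (λ z → z + (q + t1 - t2) * + n) (sym p2))))
      where rearrange : ∀ e' q t1 t2 x → e' + q * x + t1 * x ≡ e' + t2 * x + (q + t1 - t2) * x
            rearrange = solve-∀

  residue-toℕ : ∀ (i : Fin n) → residue (+ toℕ i) ≡ i
  residue-toℕ i = toℕ-injective (trans (toℕ-fromℕ< _) (m<n⇒m%n≡m (toℕ<n i)))

  residue-toℕ-≡ : ∀ e → Σ ℤ λ t → + toℕ (residue e) ≡ e + t * + n
  residue-toℕ-≡ e with natRep-≡ e
  ... | t , p = t - + (natRep e ℕ./ n) , trans (cong +_ (trans (toℕ-fromℕ< _) (m%n≡m∸m/n*n (natRep e) n)))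
        (trans (+-∸ (natRep e) _ (m/n*n≤m (natRep e) n)) (trans (cong₂ _-_ p (ℤP.pos-* (natRep e ℕ./ n) n)) (rearrange e t (+ (natRep e ℕ./ n)) (+ n))))
    where rearrange : ∀ e t q x → e + t * x - q * x ≡ e + (t - q) * x
          rearrange = solve-∀

  periodic : Vect n → ℤ → ℤ
  periodic y e = y (residue e)

  periodic-shift : ∀ y e t → periodic y (e + t * + n) ≡ periodic y e
  periodic-shift y e t = cong y (residue-periodic _ e t refl)

  act-periodic : ∀ P y x t → act P (periodic y) (x + t * + n) ≡ act P (periodic y) x
  act-periodic P y x t = sumRange-cong (window-lo (bound P)) (window-size (bound P)) _ _ (λ e → cong (coeff P e *_) (trans (cong (periodic y) (rearrange x t e (+ n))) (periodic-shift y (x + e) t)))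
    where rearrange : ∀ x t e m → x + t * m + e ≡ x + e + t * m
          rearrange = solve-∀

Sequence : Set
Sequence = ℕ → ℤ

module CompanionRecurrence (P : LPoly) (p : ℤ) (s' : ℕ) (c0 : coeff P p ≡ + 1) (cs : coeff P (p + + suc s') ≡ + 1) where
  s : ℕ
  s = suc s'

  A : Mat s s
  A = companion P p s

  coef : ℕ → ℤ
  coef j = coeff P (p + + j)

  coef-0 : coef 0 ≡ + 1
  coef-0 = trans (cong (coeff P) (ℤP.+-identityʳ p)) c0

  α : Sequence → Sequence
  α u t = sumFin (suc s) (λ j → coef (toℕ j) * u (t ℕ.+ toℕ j))

  α-split : ∀ u t → α u t ≡ sumFin s (λ j → coef (toℕ j) * u (t ℕ.+ toℕ j)) + u (t ℕ.+ s)
  α-split u t = trans (sumFin-last (suc s') (λ j → coef (toℕ j) * u (t ℕ.+ toℕ j))) (cong₂ _+_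
    (sumFin-cong s (λ j → cong (λ m → coef m * u (t ℕ.+ m)) (toℕ-inject₁ j)))
    (trans (cong (λ m → coef m * u (t ℕ.+ m)) (toℕ-fromℕ s)) (trans (cong (_* u (t ℕ.+ s)) cs) (ℤP.*-identityˡ _))))

  companion-·v-shift : ∀ (y : Vect s) (i : Fin s) (h : suc (toℕ i) ℕ.< s) → (A ·v y) i ≡ y (fromℕ< h)
  companion-·v-shift y i h = trans (sumFin-cong s (λ j → cong (λ b → (if b then (if does (toℕ j ℕ.≟ suc (toℕ i)) then + 1 else + 0)
                                                                else (if does (toℕ j ℕ.≟ 0) then - (+ 1) else - coeff P (p + + toℕ j))) * y j)
                                          (dec-true (suc (toℕ i) ℕ.<? s) h)))
    (trans (sumFin-cong s (λ j → cong (_* y j) (sym (bool→ℤ-if (does (toℕ j ℕ.≟ suc (toℕ i)))))))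
      (sumFin-unique-support s (λ j → does (toℕ j ℕ.≟ suc (toℕ i))) y (fromℕ< h)
        (λ b e → toℕ-injective (trans (≟-true⇒≡ (toℕ b) (suc (toℕ i)) e) (sym (toℕ-fromℕ< h))))
        (≡⇒≟-true (toℕ (fromℕ< h)) (suc (toℕ i)) (toℕ-fromℕ< h))))

  companion-·v-last : ∀ (y : Vect s) (i : Fin s) → ¬ (suc (toℕ i) ℕ.< s) → (A ·v y) i ≡ - sumFin s (λ j → coef (toℕ j) * y j)
  companion-·v-last y i h = trans (sumFin-cong s (λ j → trans (cong (λ b → (if b then (if does (toℕ j ℕ.≟ suc (toℕ i)) then + 1 else + 0)
                                                                else (if does (toℕ j ℕ.≟ 0) then - (+ 1) else - coeff P (p + + toℕ j))) * y j)
                                          (dec-false (suc (toℕ i) ℕ.<? s) h))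
                                          (trans (cong (_* y j) (ent j)) (sym (ℤP.neg-distribˡ-* (coef (toℕ j)) (y j))))))
                  (sumFin-neg s (λ j → coef (toℕ j) * y j))
    where
    ent' : ∀ m → (if does (m ℕ.≟ 0) then - (+ 1) else - coeff P (p + + m)) ≡ - coef m
    ent' zero = cong -_ (sym coef-0)
    ent' (suc m) = refl
    ent : ∀ j → (if does (toℕ j ℕ.≟ 0) then - (+ 1) else - coeff P (p + + toℕ j)) ≡ - coef (toℕ j)
    ent j = ent' (toℕ j)

  -- state x w t is the window (u t , … , u (t + s - 1)) of the solution u of α u = w whose first window
  -- is x; the recurrence moves it by the companion matrix, feeding w t into the last coordinate.
  injectLast : ℤ → Vect s
  injectLast c i = if does (toℕ i ℕ.≟ s') then c else + 0

  state : Vect s → Sequence → ℕ → Vect s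
  state x w zero = x
  state x w (suc t) i = (A ·v state x w t) i + injectLast (w t) i

  solution : Vect s → Sequence → Sequence
  solution x w t = state x w t Fin.zero

  injectLast-lo : ∀ c (i : Fin s) → suc (toℕ i) ℕ.< s → injectLast c i ≡ + 0
  injectLast-lo c i h = cong (λ b → if b then c else + 0) (dec-false (toℕ i ℕ.≟ s') (λ e → ℕP.<-irrefl e (ℕP.≤-pred h)))

  state-window : ∀ x w j (h : j ℕ.< s) t → state x w t (fromℕ< h) ≡ solution x w (t ℕ.+ j)
  state-window x w zero h t = cong (solution x w) (sym (ℕP.+-identityʳ t))
  state-window x w (suc j) h t =
    trans (cong (state x w t) (toℕ-injective (trans (toℕ-fromℕ< h) (sym (trans (toℕ-fromℕ< h2) (cong suc (toℕ-fromℕ< h1)))))))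
    (trans (sym (companion-·v-shift (state x w t) i h2))
    (trans (sym (trans (cong (_+_ ((A ·v state x w t) i)) (injectLast-lo (w t) i h2)) (ℤP.+-identityʳ _)))
    (trans (state-window x w j h1 (suc t)) (cong (solution x w) (sym (ℕP.+-suc t j))))))
    where
    h1 : j ℕ.< s
    h1 = ℕP.<-trans (ℕP.n<1+n j) h
    i : Fin s
    i = fromℕ< h1
    h2 : suc (toℕ i) ℕ.< s
    h2 = subst (λ z → suc z ℕ.< s) (sym (toℕ-fromℕ< h1)) h

  solution≡state : ∀ x w t (j : Fin s) → solution x w (t ℕ.+ toℕ j) ≡ state x w t j
  solution≡state x w t j = trans (sym (state-window x w (toℕ j) (toℕ<n j) t)) (cong (state x w t) (fromℕ<-toℕ j (toℕ<n j)))

  α-solution : ∀ x w t → α (solution x w) t ≡ w t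
  α-solution x w t = trans (α-split (solution x w) t)
    (trans (cong₂ _+_ (sumFin-cong s (λ j → cong (coef (toℕ j) *_) (solution≡state x w t j))) last)
    (rearrange (sumFin s (λ j → coef (toℕ j) * state x w t j)) (w t)))
    where
    rearrange : ∀ a b → a + (- a + b) ≡ b
    rearrange = solve-∀
    hs : s' ℕ.< s
    hs = ℕP.n<1+n s'
    last : solution x w (t ℕ.+ s) ≡ - sumFin s (λ j → coef (toℕ j) * state x w t j) + w t
    last = trans (cong (solution x w) (ℕP.+-suc t s')) (trans (sym (state-window x w s' hs (suc t)))
      (cong₂ _+_ (companion-·v-last (state x w t) (fromℕ< hs) (λ h → ℕP.<-irrefl (cong suc (toℕ-fromℕ< hs)) h))
                 (cong (λ b → if b then w t else + 0) (dec-true (toℕ (fromℕ< hs) ℕ.≟ s') (toℕ-fromℕ< hs)))))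

  window : Sequence → Vect s
  window u i = u (toℕ i)

  state-of-window : ∀ u t (i : Fin s) → state (window u) (α u) t i ≡ u (t ℕ.+ toℕ i)
  state-of-window u zero i = refl
  state-of-window u (suc t) i with suc (toℕ i) ℕ.<? s
  ... | yes h = trans (cong₂ _+_ (trans (lin-cong (·v-linear A) (state (window u) (α u) t) (λ j → u (t ℕ.+ toℕ j)) (state-of-window u t) i) (companion-·v-shift (λ j → u (t ℕ.+ toℕ j)) i h)) (injectLast-lo (α u t) i h))
                (trans (ℤP.+-identityʳ (u (t ℕ.+ toℕ (fromℕ< h)))) (trans (cong (λ m → u (t ℕ.+ m)) (toℕ-fromℕ< h)) (cong u (ℕP.+-suc t (toℕ i)))))
  ... | no h = trans (cong₂ _+_ (trans (lin-cong (·v-linear A) (state (window u) (α u) t) (λ j → u (t ℕ.+ toℕ j)) (state-of-window u t) i) (companion-·v-last (λ j → u (t ℕ.+ toℕ j)) i h))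
                 (trans (cong (λ b → if b then α u t else + 0) (dec-true (toℕ i ℕ.≟ s') ti)) (α-split u t)))
                (trans (rearrange (sumFin s (λ j → coef (toℕ j) * u (t ℕ.+ toℕ j))) (u (t ℕ.+ s)))
                  (cong u (trans (ℕP.+-suc t s') (cong (λ m → suc (t ℕ.+ m)) (sym ti)))))
    where
    ti : toℕ i ≡ s'
    ti = ℕP.≤-antisym (ℕP.≤-pred (toℕ<n i)) (ℕP.≮⇒≥ (λ lt → h (s≤s lt)))
    rearrange : ∀ a b → - a + (a + b) ≡ b
    rearrange = solve-∀

module PeriodicRecurrence (P : LPoly) (p : ℤ) (s' : ℕ) (c0 : coeff P p ≡ + 1) (cs : coeff P (p + + suc s') ≡ + 1) (n' : ℕ) where
  open CompanionRecurrence P p s' c0 cs public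

  n : ℕ
  n = suc n'

  zeros : Sequence
  zeros _ = + 0

  injectLast-+ : ∀ a b i → injectLast (a + b) i ≡ injectLast a i + injectLast b i
  injectLast-+ a b i with does (toℕ i ℕ.≟ s')
  ... | true = refl
  ... | false = refl

  injectLast-0 : ∀ i → injectLast (+ 0) i ≡ + 0
  injectLast-0 i with does (toℕ i ℕ.≟ s')
  ... | true = refl
  ... | false = refl

  state-cong : ∀ x x' w w' → x ≐ x' → (∀ t → w t ≡ w' t) → ∀ t → state x w t ≐ state x' w' t
  state-cong x x' w w' ex ew zero = ex
  state-cong x x' w w' ex ew (suc t) i = cong₂ _+_ (lin-cong (·v-linear A) _ _ (state-cong x x' w w' ex ew t) i) (cong (λ c → injectLast c i) (ew t))

  state-+ : ∀ x x' w w' t → state (λ i → x i + x' i) (λ t → w t + w' t) t ≐ (λ i → state x w t i + state x' w' t i)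
  state-+ x x' w w' zero i = refl
  state-+ x x' w w' (suc t) i =
    trans (cong₂ _+_ (trans (lin-cong (·v-linear A) _ _ (state-+ x x' w w' t) i) (lin-+ (·v-linear A) (state x w t) (state x' w' t) i)) (injectLast-+ (w t) (w' t) i))
      (rearrange ((A ·v state x w t) i) ((A ·v state x' w' t) i) (injectLast (w t) i) (injectLast (w' t) i))
    where rearrange : ∀ a b c d → a + b + (c + d) ≡ (a + c) + (b + d)
          rearrange = solve-∀

  extend : Vect s → Sequence
  extend x = solution x zeros

  α-section : Sequence → Sequence
  α-section w = solution (λ _ → + 0) w

  extend-linear : IsLinear extend
  extend-linear = record
    { lin-cong = λ x y e t → state-cong x y zeros zeros e (λ _ → refl) t Fin.zero
    ; lin-+ = λ x y t → state-+ x y zeros zeros t Fin.zero }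

  α-section-linear : IsLinear α-section
  α-section-linear = record
    { lin-cong = λ x y e t → state-cong _ _ x y (λ _ → refl) e t Fin.zero
    ; lin-+ = λ x y t → state-+ (λ _ → + 0) (λ _ → + 0) x y t Fin.zero }

  α-cong : ∀ u v → u ≐ v → α u ≐ α v
  α-cong u v e t = sumFin-cong (suc s) (λ j → cong (coef (toℕ j) *_) (e (t ℕ.+ toℕ j)))

  α-linear : IsLinear α
  α-linear = record
    { lin-cong = α-cong
    ; lin-+ = λ u v t → trans (sumFin-cong (suc s) (λ j → ℤP.*-distribˡ-+ (coef (toℕ j)) (u (t ℕ.+ toℕ j)) (v (t ℕ.+ toℕ j))))
                              (sumFin-add (suc s) (λ j → coef (toℕ j) * u (t ℕ.+ toℕ j)) (λ j → coef (toℕ j) * v (t ℕ.+ toℕ j))) }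

  β : Sequence → Sequence
  β u t = u (t ℕ.+ n) - u t

  β-linear : IsLinear β
  β-linear = record { lin-cong = λ u v e t → cong₂ _-_ (e (t ℕ.+ n)) (e t)
                ; lin-+ = λ u v t → rearrange (u (t ℕ.+ n)) (v (t ℕ.+ n)) (u t) (v t) }
    where rearrange : ∀ a b c d → a + b - (c + d) ≡ (a - c) + (b - d)
          rearrange = solve-∀

  α-β-comm : ∀ u t → α (β u) t ≡ β (α u) t
  α-β-comm u t = trans (sumFin-cong (suc s) {g = λ j → coef (toℕ j) * u (t ℕ.+ n ℕ.+ toℕ j) + - (coef (toℕ j) * u (t ℕ.+ toℕ j))}
              (λ j → trans (ℤP.*-distribˡ-+ (coef (toℕ j)) (u (t ℕ.+ toℕ j ℕ.+ n)) (- u (t ℕ.+ toℕ j)))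
              (cong₂ _+_ (cong (λ m → coef (toℕ j) * u m) (l2 t (toℕ j))) (sym (ℤP.neg-distribʳ-* (coef (toℕ j)) (u (t ℕ.+ toℕ j)))))))
            (trans (sumFin-add (suc s) (λ j → coef (toℕ j) * u (t ℕ.+ n ℕ.+ toℕ j)) (λ j → - (coef (toℕ j) * u (t ℕ.+ toℕ j))))
              (cong (_+_ (α u (t ℕ.+ n))) (sumFin-neg (suc s) (λ j → coef (toℕ j) * u (t ℕ.+ toℕ j)))))
    where l2 : ∀ t j → t ℕ.+ j ℕ.+ n ≡ t ℕ.+ n ℕ.+ j
          l2 t j = trans (ℕP.+-assoc t j n) (trans (cong (t ℕ.+_) (ℕP.+-comm j n)) (sym (ℕP.+-assoc t n j)))

  ker-α : ∀ u → α u ≐ zeros → u ≐ extend (window u)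
  ker-α u e t = trans (cong u (sym (ℕP.+-identityʳ t))) (trans (sym (state-of-window u t Fin.zero)) (state-cong _ _ _ _ (λ _ → refl) e t Fin.zero))

  α-α-section : ∀ w → α (α-section w) ≐ w
  α-α-section w t = α-solution (λ _ → + 0) w t

  window-extend : ∀ x → window (extend x) ≐ x
  window-extend x i = solution≡state x zeros 0 i

  state-shift : ∀ x w a b → state x w (a ℕ.+ b) ≐ state (state x w a) (λ t → w (a ℕ.+ t)) b
  state-shift x w a zero i = cong (λ m → state x w m i) (ℕP.+-identityʳ a)
  state-shift x w a (suc b) i = trans (cong (λ m → state x w m i) (ℕP.+-suc a b))
    (cong₂ _+_ (lin-cong (·v-linear A) _ _ (state-shift x w a b) i) refl)

  state-zeros : ∀ x m → state x zeros m ≐ iter (A ·v_) m x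
  state-zeros x zero i = refl
  state-zeros x (suc m) i = trans (cong₂ _+_ (lin-cong (·v-linear A) _ _ (state-zeros x m) i) (injectLast-0 i)) (ℤP.+-identityʳ _)

  K : Mat s s
  K = (A ^M n) -M idMat

  K-·v : ∀ z → (K ·v z) ≐ (λ i → state z zeros n i - z i)
  K-·v z i = trans (-M-·v (A ^M n) idMat z i) (cong₂ _-_ (trans (^M-·v A n z i) (sym (state-zeros z n i))) (idMat-·v z i))

  β-extend : ∀ z → β (extend z) ≐ extend (K ·v z)
  β-extend z t = sym (trans (lin-cong extend-linear _ _ (K-·v z) t) (trans (lin-sub extend-linear _ _ t)
    (cong (_- extend z t) (trans (sym (state-cong _ _ _ _ (λ _ → refl) (λ _ → refl) t Fin.zero))
      (trans (sym (state-shift z zeros n t Fin.zero)) (cong (extend z) (ℕP.+-comm n t)))))))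

  partialSum : Sequence → ℕ → ℕ → ℤ
  partialSum w zero r = + 0
  partialSum w (suc q) r = partialSum w q r + w (q ℕ.* n ℕ.+ r)

  β-section : Sequence → Sequence
  β-section w t = partialSum w (t / n) (t % n)

  [t+n]/n : ∀ t → (t ℕ.+ n) / n ≡ suc (t / n)
  [t+n]/n t = trans (m/n≡1+[m∸n]/n (ℕP.m≤n+m n t)) (cong (λ z → suc (z / n)) (ℕP.m+n∸n≡m t n))

  [t+n]%n : ∀ t → (t ℕ.+ n) % n ≡ t % n
  [t+n]%n t = [m+n]%n≡m%n t n

  div-mod : ∀ t → t / n ℕ.* n ℕ.+ t % n ≡ t
  div-mod t = trans (ℕP.+-comm _ (t % n)) (sym (m≡m%n+[m/n]*n t n))

  β-β-section : ∀ w → β (β-section w) ≐ w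
  β-β-section w t = trans (cong₂ (λ q r → partialSum w q r - partialSum w (t / n) (t % n)) ([t+n]/n t) ([t+n]%n t))
    (trans (rearrange (partialSum w (t / n) (t % n)) (w (t / n ℕ.* n ℕ.+ t % n))) (cong w (div-mod t)))
    where rearrange : ∀ a b → a + b - a ≡ b
          rearrange = solve-∀

  partialSum-β : ∀ u q r → partialSum (β u) q r ≡ u (q ℕ.* n ℕ.+ r) - u r
  partialSum-β u zero r = sym (ℤP.+-inverseʳ (u r))
  partialSum-β u (suc q) r = trans (cong (_+ β u (q ℕ.* n ℕ.+ r)) (partialSum-β u q r))
    (trans (rearrange (u (q ℕ.* n ℕ.+ r)) (u r) (u (q ℕ.* n ℕ.+ r ℕ.+ n))) (cong (λ m → u m - u r) e))
    where
    rearrange : ∀ a b c → a - b + (c - a) ≡ c - b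
    rearrange = solve-∀
    e : q ℕ.* n ℕ.+ r ℕ.+ n ≡ suc q ℕ.* n ℕ.+ r
    e = trans (ℕP.+-assoc (q ℕ.* n) r n) (trans (cong (q ℕ.* n ℕ.+_) (ℕP.+-comm r n)) (trans (sym (ℕP.+-assoc (q ℕ.* n) n r)) (cong (ℕ._+ r) (ℕP.+-comm (q ℕ.* n) n))))

  periodize : Vect n → Sequence
  periodize y t = y (fromℕ< (m%n<n t n))

  restrict : Sequence → Vect n
  restrict u a = u (toℕ a)

  β-section-β : ∀ u → β-section (β u) ≐ (λ t → u t - periodize (restrict u) t)
  β-section-β u t = trans (partialSum-β u (t / n) (t % n)) (cong₂ _-_ (cong u (div-mod t)) (cong u (sym (toℕ-fromℕ< (m%n<n t n)))))

  partialSum-cong : ∀ w w' → w ≐ w' → ∀ q r → partialSum w q r ≡ partialSum w' q r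
  partialSum-cong w w' e zero r = refl
  partialSum-cong w w' e (suc q) r = cong₂ _+_ (partialSum-cong w w' e q r) (e _)

  partialSum-+ : ∀ w w' q r → partialSum (λ t → w t + w' t) q r ≡ partialSum w q r + partialSum w' q r
  partialSum-+ w w' zero r = refl
  partialSum-+ w w' (suc q) r = trans (cong (_+ (w (q ℕ.* n ℕ.+ r) + w' (q ℕ.* n ℕ.+ r))) (partialSum-+ w w' q r)) (rearrange (partialSum w q r) (partialSum w' q r) (w (q ℕ.* n ℕ.+ r)) (w' (q ℕ.* n ℕ.+ r)))
    where rearrange : ∀ a b c d → a + b + (c + d) ≡ (a + c) + (b + d)
          rearrange = solve-∀

  β-section-linear : IsLinear β-section
  β-section-linear = record { lin-cong = λ w w' e t → partialSum-cong w w' e (t / n) (t % n) ; lin-+ = λ w w' t → partialSum-+ w w' (t / n) (t % n) }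

  periodize-linear : IsLinear periodize
  periodize-linear = record { lin-cong = λ x y e t → e _ ; lin-+ = λ x y t → refl }

  restrict-linear : IsLinear restrict
  restrict-linear = record { lin-cong = λ x y e a → e _ ; lin-+ = λ x y a → refl }

  window-linear : IsLinear window
  window-linear = record { lin-cong = λ x y e a → e _ ; lin-+ = λ x y a → refl }

  β-periodize : ∀ y → β (periodize y) ≐ zeros
  β-periodize y t = trans (cong (λ z → y z - periodize y t) (fromℕ<-cong _ _ ([t+n]%n t) (m%n<n (t ℕ.+ n) n) (m%n<n t n))) (ℤP.+-inverseʳ (periodize y t))

  periodize-restrict : ∀ u → β u ≐ zeros → periodize (restrict u) ≐ u
  periodize-restrict u e t = sym (ℤP.i-j≡0⇒i≡j (u t) (periodize (restrict u) t)
    (trans (sym (β-section-β u t)) (trans (lin-cong β-section-linear _ _ e t) (lin-0 β-section-linear t))))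
            where rearrange : ∀ a b → a ≡ a - b + b
                  rearrange = solve-∀

module PeriodicCoker (P : LPoly) (p : ℤ) (s' : ℕ) (lowest-coeff : coeff P p ≡ + 1) (highest-coeff : coeff P (p + + suc s') ≡ + 1) (n' : ℕ)
  (Q : Vect (suc n') → Vect (suc n')) (Q-linear : IsLinear Q) (advance retreat : Vect (suc n') → Vect (suc n'))
  where
  open PeriodicRecurrence P p s' lowest-coeff highest-coeff n' public

  module _ (Q-symbol : ∀ w → restrict (α (periodize (advance w))) ≐ Q w) (advance-retreat : ∀ y → advance (retreat y) ≐ y) where

    Q-symbol-retreat : ∀ y → restrict (α (periodize y)) ≐ Q (retreat y)
    Q-symbol-retreat y a = trans (α-cong _ _ (lin-cong periodize-linear _ _ (≐-sym (advance-retreat y))) (toℕ a)) (Q-symbol (retreat y) a)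

    β-α-zero : ∀ u → β u ≐ zeros → β (α u) ≐ zeros
    β-α-zero u e t = trans (sym (α-β-comm u t)) (trans (α-cong _ _ e t) (lin-0 α-linear t))

    window-β-ker : ∀ u → α u ≐ zeros → window (β u) ≐ (K ·v window u)
    window-β-ker u e = lin-cong window-linear _ _ (lin-cong β-linear _ _ (ker-α u e) ⟫ β-extend (window u)) ⟫ window-extend (K ·v window u)

    restrict-periodize : ∀ y → restrict (periodize y) ≐ y
    restrict-periodize y a = cong y (toℕ-injective (trans (toℕ-fromℕ< _) (m<n⇒m%n≡m (toℕ<n a))))

    toWindow : Vect n → Vect s
    toWindow y = window (β (α-section (periodize y)))

    toResidue : Vect s → Vect n
    toResidue x = restrict (α (β-section (extend x)))

    α-section-diff-ker : ∀ v w → α v ≐ w → α (λ t → α-section w t - v t) ≐ zeros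
    α-section-diff-ker v w e = lin-sub α-linear (α-section w) v ⟫ (λ t → trans (cong₂ _-_ (α-α-section w t) (e t)) (ℤP.+-inverseʳ (w t)))

    β-split : ∀ v w → β (α-section w) ≐ (λ t → β (λ t → α-section w t - v t) t + β v t)
    β-split v w t = rearrange (α-section w (t ℕ.+ n)) (α-section w t) (v (t ℕ.+ n)) (v t)
      where rearrange : ∀ a b c d → a - b ≡ (a - c - (b - d)) + (c - d)
            rearrange = solve-∀

    toWindow-im : ∀ w → Im (K ·v_) (toWindow (Q w))
    toWindow-im w = window u , ≐-sym eq
      where
      v = periodize (advance w)
      pQ : periodize (Q w) ≐ α v
      pQ = lin-cong periodize-linear _ _ (≐-sym (Q-symbol w)) ⟫ periodize-restrict (α v) (β-α-zero v (β-periodize (advance w)))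
      u = λ t → α-section (periodize (Q w)) t - v t
      ku : α u ≐ zeros
      ku = α-section-diff-ker v (periodize (Q w)) (≐-sym pQ)
      eq : toWindow (Q w) ≐ (K ·v window u)
      eq = lin-cong window-linear (β (α-section (periodize (Q w)))) (β u) (β-split v (periodize (Q w)) ⟫ (λ t → trans (cong (_+_ (β u t)) (β-periodize (advance w) t)) (ℤP.+-identityʳ (β u t))))
           ⟫ window-β-ker u ku

    toResidue-im : ∀ z → Im Q (toResidue (K ·v z))
    toResidue-im z = (λ a → - retreat y a) , ≐-sym eq
      where
      y = restrict (extend z)
      eq : toResidue (K ·v z) ≐ Q (λ a → - retreat y a)
      eq = lin-cong restrict-linear _ _ (lin-cong α-linear _ _ (lin-cong β-section-linear _ _ (≐-sym (β-extend z)) ⟫ β-section-β (extend z))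
             ⟫ lin-sub α-linear (extend z) (periodize y))
           ⟫ (λ a → trans (cong (_- α (periodize y) (toℕ a)) (α-solution _ zeros (toℕ a))) (ℤP.+-identityˡ _))
           ⟫ (λ a → cong -_ (Q-symbol-retreat y a))
           ⟫ ≐-sym (lin-neg Q-linear (retreat y))

    toResidue∘toWindow : ∀ y → Im Q (λ i → toResidue (toWindow y) i - y i)
    toResidue∘toWindow y = (λ a → - retreat (restrict u) a) , ≐-sym eq
      where
      u = α-section (periodize y)
      au : α u ≐ periodize y
      au = α-α-section (periodize y)
      kb : α (β u) ≐ zeros
      kb t = trans (α-β-comm u t) (trans (lin-cong β-linear _ _ au t) (β-periodize y t))
      eq : (λ i → toResidue (toWindow y) i - y i) ≐ Q (λ a → - retreat (restrict u) a)
      eq = (λ a → cong (_- y a) (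
             (lin-cong restrict-linear _ _ (lin-cong α-linear _ _ (lin-cong β-section-linear _ _ (≐-sym (ker-α (β u) kb)) ⟫ β-section-β u) ⟫ lin-sub α-linear u (periodize (restrict u)))
             ⟫ (λ b → cong₂ _-_ (trans (au (toℕ b)) (restrict-periodize y b)) (Q-symbol-retreat (restrict u) b))) a))
           ⟫ (λ a → rearrange′ (y a) (Q (retreat (restrict u)) a))
           ⟫ ≐-sym (lin-neg Q-linear (retreat (restrict u)))
        where rearrange′ : ∀ a b → a - b - a ≡ - b
              rearrange′ = solve-∀

    toWindow∘toResidue : ∀ x → Im (K ·v_) (λ i → toWindow (toResidue x) i - x i)
    toWindow∘toResidue x = window u , ≐-sym eq
      where
      v = β-section (extend x)
      bv : β v ≐ extend x
      bv = β-β-section (extend x)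
      pa : periodize (restrict (α v)) ≐ α v
      pa = periodize-restrict (α v) (λ t → trans (sym (α-β-comm v t)) (trans (lin-cong α-linear _ _ bv t) (α-solution x zeros t)))
      u = λ t → α-section (α v) t - v t
      ku : α u ≐ zeros
      ku = α-section-diff-ker v (α v) (λ _ → refl)
      eq : (λ i → toWindow (toResidue x) i - x i) ≐ (K ·v window u)
      eq = (λ i → cong (_- x i) ((lin-cong window-linear _ _ (lin-cong β-linear _ _ (lin-cong α-section-linear _ _ pa) ⟫ β-split v (α v)
               ⟫ (λ t → cong (_+_ (β u t)) (bv t))) ⟫ (λ j → cong (_+_ (window (β u) j)) (window-extend x j))) i))
           ⟫ (λ i → rearrange″ (window (β u) i) (x i))
           ⟫ window-β-ker u ku
        where rearrange″ : ∀ a b → a + b - b ≡ a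
              rearrange″ = solve-∀

    cokerIso-companion : CokerIso Q (K ·v_)
    cokerIso-companion = record
      { to = toWindow ; from = toResidue
      ; to-linear = lin-∘ window-linear (lin-∘ β-linear (lin-∘ α-section-linear periodize-linear))
      ; from-linear = lin-∘ restrict-linear (lin-∘ α-linear (lin-∘ β-section-linear extend-linear))
      ; to-im = toWindow-im ; from-im = toResidue-im ; from∘to = toResidue∘toWindow ; to∘from = toWindow∘toResidue }

module CirculantSymbol (n' : ℕ) {k l : ℕ} (s₁ : Fin k → ℕ) (s₂ : Fin l → ℕ)
  (V₁ : ValidSteps (suc n') s₁) (V₂ : ValidSteps (suc n') s₂) where
  open ConeOverCobordism n' s₁ s₂ V₁ V₂
  open Periodic n' using (periodic; residue; residue-periodic; residue-toℕ; residue-toℕ-≡; act-periodic; periodic-shift)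

  diagMinusCirc≡act : ∀ {m} (st : Fin m → ℕ) (V : ValidSteps (suc n') st) (u : Vect n) (a : Fin n) →
    + (2 ℕ.* m ℕ.+ 2) * u a - sumFin n (λ b → bool→ℤ (circAdj n st a b) * u b) ≡ act (factorLP m st) (periodic u) (+ toℕ a)
  diagMinusCirc≡act {m} st V u a = sym (trans (act-factorLP m st (periodic u) (+ toℕ a))
    (cong₂ _-_ (cong (λ z → + (2 ℕ.* m ℕ.+ 2) * z) (cong u (residue-toℕ a)))
      (trans (sumFin-cong m {g = λ r → u (C.fwd a r) + u (C.bwd a r)}
               (λ r → cong (_+_ (u (C.fwd a r))) (cong u (residue-periodic (+ toℕ a - + st r) (+ (toℕ a ℕ.+ (n ∸ st r))) (- + 1) (eq r)))))
             (sym (C.circSum-≡ u a)))))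
    where
    module C = Circulant n' st V
    eq : ∀ r → + toℕ a - + st r ≡ + toℕ a + + (n ∸ st r) + (- + 1) * + n
    eq r = trans (rearrange (+ toℕ a) (+ st r) (+ n)) (cong (λ z → + toℕ a + z + (- + 1) * + n) (sym (+-∸ n (st r) (ℕP.<⇒≤ (C.step<n r)))))
      where rearrange : ∀ a s m → a - s ≡ a + (m - s) + (- + 1) * m
            rearrange = solve-∀

  F₁≡act : ∀ u a → F₁ u a ≡ act (factorLP k s₁) (periodic u) (+ toℕ a)
  F₁≡act = diagMinusCirc≡act s₁ V₁
  F₂≡act : ∀ u a → F₂ u a ≡ act (factorLP l s₂) (periodic u) (+ toℕ a)
  F₂≡act = diagMinusCirc≡act s₂ V₂

  Q : Vect n → Vect n
  Q = schur F₁ F₂ F₁-linear F₂-linear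

  schur≡act : ∀ w a → Q w a ≡ act (thePoly k l s₁ s₂) (periodic w) (+ toℕ a)
  schur≡act w a = trans (cong₂ _-_ (trans (F₁≡act (F₂ w) a) (act-cong (factorLP k s₁) _ _ periodic-F₂ (+ toℕ a))) (cong w (sym (residue-toℕ a))))
    (sym (act-thePoly k l s₁ s₂ (periodic w) (+ toℕ a)))
    where
    periodic-F₂ : ∀ z → periodic (F₂ w) z ≡ act (factorLP l s₂) (periodic w) z
    periodic-F₂ z with residue-toℕ-≡ z
    ... | t , e = trans (F₂≡act w (residue z)) (trans (cong (act (factorLP l s₂) (periodic w)) e) (act-periodic (factorLP l s₂) w z t))

  module _ (p : ℤ) (s' : ℕ) (bim : Bimonic (thePoly k l s₁ s₂) p (suc s')) where
    P : LPoly
    P = thePoly k l s₁ s₂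

    lowest-coeff : coeff P p ≡ + 1
    lowest-coeff = proj₁ (proj₂ bim)
    highest-coeff : coeff P (p + + suc s') ≡ + 1
    highest-coeff = proj₁ (proj₂ (proj₂ bim))
    vanishes-beyond : ∀ e → (e ℤ.< p) ⊎ (p + + suc s' ℤ.< e) → coeff P e ≡ + 0
    vanishes-beyond = proj₂ (proj₂ (proj₂ bim))

    thePoly-vanishes : VanishesOutside p (suc (suc s')) (coeff P)
    thePoly-vanishes e (inj₁ x) = vanishes-beyond e (inj₁ (Le-suc⇒< x))
    thePoly-vanishes e (inj₂ x) = vanishes-beyond e (inj₂ (Le-suc⇒< (subst (λ z → Le z e) (assoc p (+ suc s')) x)))
      where assoc : ∀ p s → p + (+ 1 + s) ≡ p + s + + 1
            assoc = solve-∀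

    module R = PeriodicRecurrence P p s' lowest-coeff highest-coeff n'

    advance retreat : Vect n → Vect n
    advance w b = periodic w (+ toℕ b + p)
    retreat y b = periodic y (+ toℕ b - p)

    periodic-advance : ∀ w z → periodic (advance w) z ≡ periodic w (z + p)
    periodic-advance w z with residue-toℕ-≡ z
    ... | t , e = trans (cong (periodic w) (trans (cong (_+ p) e) (rearrange z t (+ n) p))) (periodic-shift w (z + p) t)
      where rearrange : ∀ z t m p → z + t * m + p ≡ z + p + t * m
            rearrange = solve-∀

    periodic-retreat : ∀ y z → periodic (retreat y) z ≡ periodic y (z - p)
    periodic-retreat y z with residue-toℕ-≡ z
    ... | t , e = trans (cong (periodic y) (trans (cong (_- p) e) (rearrange z t (+ n) p))) (periodic-shift y (z - p) t)
      where rearrange : ∀ z t m p → z + t * m - p ≡ z - p + t * m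
            rearrange = solve-∀

    advance-retreat : ∀ y → advance (retreat y) ≐ y
    advance-retreat y b = trans (periodic-retreat y (+ toℕ b + p)) (trans (cong (periodic y) (rearrange (+ toℕ b) p)) (cong y (residue-toℕ b)))
      where rearrange : ∀ b p → b + p - p ≡ b
            rearrange = solve-∀

    Q-symbol : ∀ w → R.restrict (R.α (R.periodize (advance w))) ≐ Q w
    Q-symbol w a = sym (trans (schur≡act w a)
      (trans (sym (act-on-range P (supported-thePoly k l s₁ s₂) p (suc (suc s')) thePoly-vanishes (periodic w) (+ toℕ a)))
      (trans (sumRange≡sumFin p (suc (suc s')) (λ e → coeff P e * periodic w (+ toℕ a + e)))
        (sumFin-cong (suc (suc s')) (λ j → cong (coeff P (p + + toℕ j) *_)
          (trans (cong (periodic w) (rearrange (+ toℕ a) p (+ toℕ j))) (sym (periodic-advance w (+ (toℕ a ℕ.+ toℕ j))))))))))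
      where rearrange : ∀ a p j → a + (p + j) ≡ a + j + p
            rearrange = solve-∀

    cokerIso-schur-companion : CokerIso Q ((((companion P p (suc s')) ^M n) -M idMat) ·v_)
    cokerIso-schur-companion = PeriodicCoker.cokerIso-companion P p s' lowest-coeff highest-coeff n' Q (schur-linear F₁ F₂ F₁-linear F₂-linear) advance retreat
      Q-symbol advance-retreat

jacIso-coneCobordism : ∀ n' {k l} (s₁ : Fin k → ℕ) (s₂ : Fin l → ℕ) → ValidSteps (suc n') s₁ → ValidSteps (suc n') s₂ →
  ∀ p s' → Bimonic (thePoly k l s₁ s₂) p (suc s') →
  JacIso (coneCobAdj (suc n') s₁ s₂) ((companion (thePoly k l s₁ s₂) p (suc s') ^M suc n') -M idMat)
jacIso-coneCobordism n' {k} {l} s₁ s₂ V₁ V₂ p s' bim =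
  torsCokerIso-cone K (cokerIso-trans (·v-linear Lred) (·v-linear K)
    cokerIso-Lred-schur (cokerIso-schur-companion p s' bim))
  where
  open ConeOverCobordism n' s₁ s₂ V₁ V₂
  open CirculantSymbol n' s₁ s₂ V₁ V₂ using (cokerIso-schur-companion)
  K : Mat (suc s') (suc s')
  K = (companion (thePoly k l s₁ s₂) p (suc s') ^M suc n') -M idMat

-- n = 0 contradicts 2 s₁,₁ < n (the only use of k ≥ 1) and s = 0 contradicts bimonicity.
theorem5 : (n k l : ℕ) → 1 ≤ k → 1 ≤ l →
             (s₁ : Fin k → ℕ) (s₂ : Fin l → ℕ) →
             ValidSteps n s₁ → ValidSteps n s₂ →
             (p : ℤ) (s : ℕ) → Bimonic (thePoly k l s₁ s₂) p s →
             JacIso (coneCobAdj n s₁ s₂)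
                    ((companion (thePoly k l s₁ s₂) p s ^M n) -M idMat)
theorem5 zero (suc k) l _ _ s₁ s₂ (_ , 2s₁<0 , _) _ p s bim with 2s₁<0 Fin.zero
... | ()
theorem5 (suc n') k l _ _ s₁ s₂ V₁ V₂ p zero (() , _)
theorem5 (suc n') k l _ _ s₁ s₂ V₁ V₂ p (suc s') bim = jacIso-coneCobordism n' s₁ s₂ V₁ V₂ p s' bim
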